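{- For any $\mathbb{C}_\theta$-kernel $s \colon \varnothing \to W \cup X \cup Y$ where $W, X, Y$ are mutually disjoint finite sets of variables, $s$ displays the (plain) conditional independence of $X$ and $Y$ given $W$ if and only if $X$ and $Y$ are DIBI conditionally independent given $W$ in $s$, i.e. $s \models_{\mathcal{V}} (\varnothing \triangleright W) \mathbin{⨟} \big( (W \triangleright X) * (W \triangleright Y) \big)$.
   Context: Fix a countably infinite set of variables $\mathrm{Var}$ with a linear order $\prec$; finite sets of variables are represented as $\prec$-ordered duplicate-free lists. Fix a Markov category $(\mathbb{C},\otimes,\mathsf{I})$ (a symmetric monoidal category with commutative comonoids $\mathsf{copy}_\mathsf{C}\colon \mathsf{C}\to\mathsf{C}\otimes\mathsf{C}$, $\mathsf{del}_\mathsf{C}\colon\mathsf{C}\to\mathsf{I}$ compatible with $\otimes$, with $\mathsf{del}$ natural) and an assignment $\theta\colon \mathrm{Var}\to \mathrm{ob}(\mathbb{C})$. $\mathbb{C}_\theta$ is the Markov category whose objects are finite lists of variables and whose morphisms $[x_1,\dots,x_m]\to[y_1,\dots,y_n]$ are $\mathbb{C}$-morphisms $\theta(x_1)\otimes\cdots\otimes\theta(x_m)\to\theta(y_1)\otimes\cdots\otimes\theta(y_n)$, composition and $\otimes$ (list concatenation on objects) inherited from $\mathbb{C}$. A $\mathbb{C}_\theta$-kernel (input-preserving kernel) $f\colon X\to Y$ (with $X,Y$ given as ordered lists) is a morphism of the form $\sigma\circ(\mathit{id}_X\otimes f')\circ \mathsf{copy}_X$ for some $f'\colon X\to Y\setminus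 X$ and rewiring (symmetry) $\sigma$; so $X\subseteq Y$ and the input is copied to the output. Sequential composition: $f\odot g = g\circ f$, defined iff $\mathrm{cod} f=\mathrm{dom} g$. Parallel composition of $f\colon X\to Y$, $g\colon U\to V$ is defined iff $X\cap U = Y\cap V$, and then $f\oplus g\colon X\cup U\to Y\cup V$ copies the shared input wires $X\cap U$, feeds them (with $X\setminus U$, resp. $U\setminus X$) to the nontrivial parts of $f$ and $g$, keeps the inputs, and rewires outputs into $\prec$-order. Subkernel: $f\sqsubseteq g$ iff $g = (f\oplus \mathit{id}_Z)\odot h$ for some finite set of variables $Z$ and kernel $h$ (equivalently $g=\sigma_2\circ h\circ(f\otimes\mathit{id}_Z)\circ\sigma_1$ with rewirings $\sigma_i$). Satisfaction in the DIBI model with natural valuation $\mathcal{V}$: $f\models (S\triangleright T)$ iff there is a subkernel $f'\colon X'\to Y'$, $f'\sqsubseteq f$, with $X'=S$ and $T\subseteq Y'$; $a\models P*Q$ iff there exist $b_1,b_2$ with $b_1\oplus b_2\sqsubseteq a$, $b_1\models P$, $b_2\models Q$; $a\models P\mathbin{⨟}Q$ iff there exist $b_1,b_2$ with $b_1\odot b_2=a$, $b_1\models P$, $b_2\models Q$. Here $\mathbin{⨟}$ is the non-commutative (sequential/dependence) conjunction of DIBI logic and $*$ the separating (independence) conjunction. Plain CI: a morphism $s\colon\mathsf{I}\to\mathsf{W}\otimes\mathsf{X}\otimes\mathsf{Y}$ displays the conditional independence of $\mathsf{X}$ and $\mathsf{Y}$ given $\mathsf{W}$ if there exist $s_\mathsf{W}\colon\mathsf{I}\to\mathsf{W}$,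 $g_\mathsf{X}\colon\mathsf{W}\to\mathsf{X}$, $g_\mathsf{Y}\colon\mathsf{W}\to\mathsf{Y}$ such that $s = (\mathit{id}_\mathsf{W}\otimes g_\mathsf{X}\otimes g_\mathsf{Y})\circ \mathsf{copy}^{(3)}_\mathsf{W}\circ s_\mathsf{W}$, where $\mathsf{copy}^{(3)}_\mathsf{W}\colon \mathsf{W}\to\mathsf{W}\otimes\mathsf{W}\otimes\mathsf{W}$ is the threefold copy. -}

module Defs where

open import Level using (Level; _⊔_; suc)
open import Data.Nat using (ℕ)
open import Data.List using (List; []; _∷_; _++_; filter)
open import Data.Product using (Σ; Σ-syntax; ∃; ∃-syntax; _×_; _,_)
open import Relation.Nullary using (¬_; ¬?)
open import Relation.Binary using (Rel; IsEquivalence; IsStrictTotalOrder; Tri; tri<; tri≈; tri>)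
open import Relation.Binary.PropositionalEquality using (_≡_; refl)
open import Function.Bundles using (_↔_)
open import Data.List.Relation.Unary.Linked using (Linked)
open import Data.List.Relation.Binary.Permutation.Propositional using (_↭_; refl; prep; swap; trans)
import Data.List.Relation.Binary.Subset.Propositional as Sub
import Data.List.Membership.DecPropositional as DecMem

record MarkovCategory (o ℓ e : Level) : Set (suc (o ⊔ ℓ ⊔ e)) where
  infixr 9 _∘_
  infixr 10 _⊗₀_ _⊗₁_
  infix 4 _≈_
  field
    Ob   : Set o
    Hom  : Ob → Ob → Set ℓ
    _≈_  : ∀ {A B} → Rel (Hom A B) e
    ≈-equiv : ∀ {A B} → IsEquivalence (_≈_ {A} {B})
    id   : ∀ {A} → Hom A A
    _∘_  : ∀ {A B C} → Hom B C → Hom A B → Hom A C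
    ∘-resp-≈ : ∀ {A B C} {f f' : Hom B C} {g g' : Hom A B} → f ≈ f' → g ≈ g' → f ∘ g ≈ f' ∘ g'
    identityˡ : ∀ {A B} {f : Hom A B} → id ∘ f ≈ f
    identityʳ : ∀ {A B} {f : Hom A B} → f ∘ id ≈ f
    assoc : ∀ {A B C D} {f : Hom A B} {g : Hom B C} {h : Hom C D} → (h ∘ g) ∘ f ≈ h ∘ (g ∘ f)
    I    : Ob
    _⊗₀_ : Ob → Ob → Ob
    _⊗₁_ : ∀ {A B C D} → Hom A B → Hom C D → Hom (A ⊗₀ C) (B ⊗₀ D)
    ⊗-resp-≈ : ∀ {A B C D} {f f' : Hom A B} {g g' : Hom C D} → f ≈ f' → g ≈ g' → f ⊗₁ g ≈ f' ⊗₁ g'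
    ⊗-id : ∀ {A B} → id {A} ⊗₁ id {B} ≈ id
    ⊗-∘ : ∀ {A B C D E F} {f : Hom A B} {g : Hom B C} {h : Hom D E} {k : Hom E F} →
          (g ∘ f) ⊗₁ (k ∘ h) ≈ (g ⊗₁ k) ∘ (f ⊗₁ h)
    α⇒ : ∀ {A B C} → Hom ((A ⊗₀ B) ⊗₀ C) (A ⊗₀ (B ⊗₀ C))
    α⇐ : ∀ {A B C} → Hom (A ⊗₀ (B ⊗₀ C)) ((A ⊗₀ B) ⊗₀ C)
    α-iso₁ : ∀ {A B C} → α⇐ {A} {B} {C} ∘ α⇒ ≈ id
    α-iso₂ : ∀ {A B C} → α⇒ {A} {B} {C} ∘ α⇐ ≈ id
    α-natural : ∀ {A B C D E F} {f : Hom A D} {g : Hom B E} {h : Hom C F} →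
                α⇒ ∘ ((f ⊗₁ g) ⊗₁ h) ≈ (f ⊗₁ (g ⊗₁ h)) ∘ α⇒
    λ⇒ : ∀ {A} → Hom (I ⊗₀ A) A
    λ⇐ : ∀ {A} → Hom A (I ⊗₀ A)
    λ-iso₁ : ∀ {A} → λ⇐ {A} ∘ λ⇒ ≈ id
    λ-iso₂ : ∀ {A} → λ⇒ {A} ∘ λ⇐ ≈ id
    λ-natural : ∀ {A B} {f : Hom A B} → λ⇒ ∘ (id ⊗₁ f) ≈ f ∘ λ⇒
    ρ⇒ : ∀ {A} → Hom (A ⊗₀ I) A
    ρ⇐ : ∀ {A} → Hom A (A ⊗₀ I)
    ρ-iso₁ : ∀ {A} → ρ⇐ {A} ∘ ρ⇒ ≈ id
    ρ-iso₂ : ∀ {A} → ρ⇒ {A} ∘ ρ⇐ ≈ id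
    ρ-natural : ∀ {A B} {f : Hom A B} → ρ⇒ ∘ (f ⊗₁ id) ≈ f ∘ ρ⇒
    pentagon : ∀ {A B C D} →
      (id {A} ⊗₁ α⇒ {B} {C} {D}) ∘ α⇒ ∘ (α⇒ ⊗₁ id) ≈ α⇒ ∘ α⇒
    triangle : ∀ {A B} → (id {A} ⊗₁ λ⇒ {B}) ∘ α⇒ ≈ ρ⇒ ⊗₁ id
    σ : ∀ {A B} → Hom (A ⊗₀ B) (B ⊗₀ A)
    σ-natural : ∀ {A B C D} {f : Hom A B} {g : Hom C D} → σ ∘ (f ⊗₁ g) ≈ (g ⊗₁ f) ∘ σ
    σ-involutive : ∀ {A B} → σ {B} {A} ∘ σ {A} {B} ≈ id
    hexagon : ∀ {A B C} →
      (id {B} ⊗₁ σ {A} {C}) ∘ α⇒ ∘ (σ ⊗₁ id) ≈ α⇒ ∘ σ ∘ α⇒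
    copy : ∀ {A} → Hom A (A ⊗₀ A)
    del  : ∀ {A} → Hom A I
    copy-counitˡ : ∀ {A} → (del ⊗₁ id) ∘ copy {A} ≈ λ⇐
    copy-counitʳ : ∀ {A} → (id ⊗₁ del) ∘ copy {A} ≈ ρ⇐
    copy-coassoc : ∀ {A} → α⇒ ∘ (copy ⊗₁ id) ∘ copy {A} ≈ (id ⊗₁ copy) ∘ copy
    copy-comm : ∀ {A} → σ ∘ copy {A} ≈ copy
    copy-⊗ : ∀ {A B} →
      copy {A ⊗₀ B} ≈ α⇐ ∘ (id ⊗₁ (α⇒ ∘ (σ ⊗₁ id) ∘ α⇐)) ∘ α⇒ ∘ (copy ⊗₁ copy)
    copy-I : copy {I} ≈ λ⇐
    del-⊗ : ∀ {A B} → del {A ⊗₀ B} ≈ λ⇒ ∘ (del ⊗₁ del)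
    del-I : del {I} ≈ id
    del-natural : ∀ {A B} {f : Hom A B} → del ∘ f ≈ del

record VarStructure : Set₁ where
  field
    Var : Set
    _≺_ : Rel Var Level.zero
    isStrictTotalOrder : IsStrictTotalOrder _≡_ _≺_
    countablyInfinite : Var ↔ ℕ

module Theory {o ℓ e : Level} (𝒱 : VarStructure) (C : MarkovCategory o ℓ e)
              (θ : VarStructure.Var 𝒱 → MarkovCategory.Ob C) where

  open VarStructure 𝒱 public
  open MarkovCategory C public
  open IsStrictTotalOrder isStrictTotalOrder using (compare; _≟_)
  open DecMem _≟_ using (_∈?_)
  open Sub using (_⊆_) public

  -- finite sets of variables: ≺-ordered (hence duplicate-free) lists
  Sorted : List Var → Set
  Sorted = Linked _≺_

  _∪_ : List Var → List Var → List Var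
  [] ∪ ys = ys
  (x ∷ xs) ∪ ys = go ys
    where
      go : List Var → List Var
      go [] = x ∷ xs
      go (y ∷ ys') with compare x y
      ... | tri< _ _ _ = x ∷ (xs ∪ (y ∷ ys'))
      ... | tri≈ _ _ _ = x ∷ (xs ∪ ys')
      ... | tri> _ _ _ = y ∷ go ys'

  _∩_ : List Var → List Var → List Var
  xs ∩ ys = filter (λ x → x ∈? ys) xs

  _∖_ : List Var → List Var → List Var
  ys ∖ xs = filter (λ y → ¬? (y ∈? xs)) ys

  ⟦_⟧ : List Var → Ob
  ⟦ [] ⟧ = I
  ⟦ x ∷ xs ⟧ = θ x ⊗₀ ⟦ xs ⟧

  μ : ∀ xs ys → Hom (⟦ xs ⟧ ⊗₀ ⟦ ys ⟧) ⟦ xs ++ ys ⟧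
  μ [] ys = λ⇒
  μ (x ∷ xs) ys = (id ⊗₁ μ xs ys) ∘ α⇒

  μ⁻¹ : ∀ xs ys → Hom ⟦ xs ++ ys ⟧ (⟦ xs ⟧ ⊗₀ ⟦ ys ⟧)
  μ⁻¹ [] ys = λ⇐
  μ⁻¹ (x ∷ xs) ys = α⇐ ∘ (id ⊗₁ μ⁻¹ xs ys)

  -- tensor and copy of C_θ (objects: lists, ⊗ = concatenation)
  tensθ : ∀ a b c d → Hom ⟦ a ⟧ ⟦ b ⟧ → Hom ⟦ c ⟧ ⟦ d ⟧ → Hom ⟦ a ++ c ⟧ ⟦ b ++ d ⟧
  tensθ a b c d f g = μ b d ∘ (f ⊗₁ g) ∘ μ⁻¹ a c

  copyθ : ∀ xs → Hom ⟦ xs ⟧ ⟦ xs ++ xs ⟧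
  copyθ xs = μ xs xs ∘ copy

  copy3θ : ∀ xs → Hom ⟦ xs ⟧ ⟦ xs ++ (xs ++ xs) ⟧
  copy3θ xs = tensθ xs xs xs (xs ++ xs) id (copyθ xs) ∘ copyθ xs

  -- rewirings: label-respecting symmetries, one for each permutation proof
  rewire : ∀ {xs ys} → xs ↭ ys → Hom ⟦ xs ⟧ ⟦ ys ⟧
  rewire refl = id
  rewire (prep x p) = id ⊗₁ rewire p
  rewire (swap x y p) = (id ⊗₁ (id ⊗₁ rewire p)) ∘ α⇒ ∘ (σ ⊗₁ id) ∘ α⇐
  rewire (trans p q) = rewire q ∘ rewire p

  proj : ∀ xs bs → Hom ⟦ xs ++ bs ⟧ ⟦ xs ⟧
  proj xs bs = ρ⇒ ∘ (id ⊗₁ del) ∘ μ⁻¹ xs bs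

  record Raw : Set (ℓ) where
    constructor mk
    field
      dom : List Var
      cod : List Var
      mor : Hom ⟦ dom ⟧ ⟦ cod ⟧
  open Raw public

  cast : ∀ {xs xs' ys ys'} → xs ≡ xs' → ys ≡ ys' → Hom ⟦ xs ⟧ ⟦ ys ⟧ → Hom ⟦ xs' ⟧ ⟦ ys' ⟧
  cast refl refl f = f

  _≈K_ : Raw → Raw → Set e
  a ≈K b = Σ (dom a ≡ dom b) λ p → Σ (cod a ≡ cod b) λ q → cast p q (mor a) ≈ mor b

  seqK : (a b : Raw) → cod a ≡ dom b → Raw
  seqK a b q = mk (dom a) (cod b) (mor b ∘ cast {dom a} {dom a} {cod a} {dom b} refl q (mor a))

  -- f' is the nontrivial part of the kernel a : X → Y, i.e.
  -- mor a = σ ∘ (id_X ⊗ f') ∘ copy_X for some rewiring σ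
  KernelRep : (a : Raw) → Hom ⟦ dom a ⟧ ⟦ cod a ∖ dom a ⟧ → Set e
  KernelRep a f' = Σ ((dom a ++ (cod a ∖ dom a)) ↭ cod a) λ p →
    mor a ≈ rewire p ∘ μ (dom a) (cod a ∖ dom a) ∘ (id ⊗₁ f') ∘ copy

  IsKernel : Raw → Set (ℓ ⊔ e)
  IsKernel a = Σ (Hom ⟦ dom a ⟧ ⟦ cod a ∖ dom a ⟧) (KernelRep a)

  -- C_θ-kernels between finite sets of variables (states of the DIBI model)
  record Kernel : Set (ℓ ⊔ e) where
    field
      raw : Raw
      dom-sorted : Sorted (dom raw)
      cod-sorted : Sorted (cod raw)
      isKernel : IsKernel raw
  open Kernel public

  -- h = a ⊕ b : X ∪ U → Y ∪ V  (a : X → Y, b : U → V, defined iff X ∩ U = Y ∩ V)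
  -- The shared inputs are copied, restricted to X resp. U, fed to the
  -- nontrivial parts of a and b; inputs are kept; outputs rewired.
  ParMor : (a b : Raw) → Hom ⟦ dom a ∪ dom b ⟧ ⟦ cod a ∪ cod b ⟧ → Set (ℓ ⊔ e)
  ParMor a b h =
    (dom a ∩ dom b ≡ cod a ∩ cod b) ×
    Σ (Hom ⟦ X ⟧ ⟦ Y' ⟧) λ f' → Σ (Hom ⟦ U ⟧ ⟦ V' ⟧) λ g' →
    KernelRep a f' × KernelRep b g' ×
    Σ (Z ↭ (X ++ (Z ∖ X))) λ p₁ → Σ (Z ↭ (U ++ (Z ∖ U))) λ p₂ →
    Σ ((Z ++ (Y' ++ V')) ↭ (cod a ∪ cod b)) λ p →
      h ≈ rewire p ∘ μ Z (Y' ++ V')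
            ∘ (id ⊗₁ (μ Y' V' ∘ ((f' ∘ proj X (Z ∖ X) ∘ rewire p₁)
                                 ⊗₁ (g' ∘ proj U (Z ∖ U) ∘ rewire p₂)) ∘ copy))
            ∘ copy
    where
      X = dom a
      U = dom b
      Z = dom a ∪ dom b
      Y' = cod a ∖ dom a
      V' = cod b ∖ dom b

  idRaw : List Var → Raw
  idRaw Z = mk Z Z id

  -- subkernel: f ⊑ g iff g = (f ⊕ id_Z) ⊙ h for some finite set Z and kernel h
  _⊑_ : Raw → Raw → Set (ℓ ⊔ e)
  f ⊑ g = Σ (List Var) λ Z → Sorted Z × Σ (Hom ⟦ dom f ∪ Z ⟧ ⟦ cod f ∪ Z ⟧) λ k →
    ParMor f (idRaw Z) k × Σ Kernel λ h → Σ (cod f ∪ Z ≡ dom (raw h)) λ q →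
      seqK (mk (dom f ∪ Z) (cod f ∪ Z) k) (raw h) q ≈K g

  -- satisfaction for the DIBI connectives (natural valuation), on states
  Pred : Set (suc (ℓ ⊔ e))
  Pred = Raw → Set (ℓ ⊔ e)

  _▷_ : List Var → List Var → Pred
  (S ▷ T) a = Σ Kernel λ f' → raw f' ⊑ a × dom (raw f') ≡ S × T ⊆ cod (raw f')

  _✶_ : Pred → Pred → Pred
  (P ✶ Q) a = Σ Kernel λ b₁ → Σ Kernel λ b₂ →
    Σ (Hom ⟦ dom (raw b₁) ∪ dom (raw b₂) ⟧ ⟦ cod (raw b₁) ∪ cod (raw b₂) ⟧) λ h →
      ParMor (raw b₁) (raw b₂) h ×
      mk (dom (raw b₁) ∪ dom (raw b₂)) (cod (raw b₁) ∪ cod (raw b₂)) h ⊑ a ×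
      P (raw b₁) × Q (raw b₂)

  _⨟_ : Pred → Pred → Pred
  (P ⨟ Q) a = Σ Kernel λ b₁ → Σ Kernel λ b₂ →
    Σ (cod (raw b₁) ≡ dom (raw b₂)) λ q →
      seqK (raw b₁) (raw b₂) q ≈K a × P (raw b₁) × Q (raw b₂)

  DIBI-CI : (W X Y : List Var) → Raw → Set (ℓ ⊔ e)
  DIBI-CI W X Y s = (([] ▷ W) ⨟ ((W ▷ X) ✶ (W ▷ Y))) s

  DisplaysCI : (W X Y : List Var) → Hom ⟦ [] ⟧ ⟦ (W ∪ X) ∪ Y ⟧ → Set (ℓ ⊔ e)
  DisplaysCI W X Y s =
    Σ (Hom I ⟦ W ⟧) λ s_W → Σ (Hom ⟦ W ⟧ ⟦ X ⟧) λ g_X → Σ (Hom ⟦ W ⟧ ⟦ Y ⟧) λ g_Y →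
    Σ ((W ++ (X ++ Y)) ↭ ((W ∪ X) ∪ Y)) λ p →
      s ≈ rewire p ∘ tensθ W W (W ++ W) (X ++ Y) id (tensθ W X W Y g_X g_Y) ∘ copy3θ W ∘ s_W

-- A DIBI witness of (∅ ▷ W) ⨟ ((W ▷ X) ∗ (W ▷ Y)) splits s into a state on some E₁ followed by a kernel
-- b₂ : E₁ → R containing, as a subkernel, the parallel composition c₁ ⊕ c₂ of kernels A₁ → B₁ and A₂ → B₂.
-- The interface conditions of ⊑ (outputs of a subkernel that are inputs of the whole are inputs of the
-- subkernel) and of ⊕ (shared outputs are shared inputs), together with the disjointness of W, X and Y, force
-- E₁ = A₁ = A₂ = W, B₁ ∖ W = X and B₂ ∖ W = Y. So c₁ ⊕ c₂ is (id_W ⊗ g_X ⊗ g_Y) ∘ copy³_W, and since it has the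
-- inputs of b₂ and covers its outputs, b₂ is c₁ ⊕ c₂ up to a rewiring. Conversely such a factorisation of s is
-- itself a witness. The arbitrary rewirings a witness may contain are harmless, because rewirings of
-- duplicate-free lists are determined by their endpoints (symmetric monoidal coherence).
module Submission where

open import Defs
open import Level using (Level; _⊔_)
open import Data.Empty using (⊥; ⊥-elim)
open import Data.List using (List; []; _∷_; _++_)
open import Data.List.Properties using (filter-all; filter-none)
open import Data.List.Membership.Propositional using (_∈_; _∉_)
open import Data.List.Membership.Propositional.Properties using (∈-filter⁻; ∈-filter⁺; ∈-++⁻; ∈-++⁺ˡ; ∈-++⁺ʳ)
open import Data.List.Membership.Propositional.Properties.WithK using (unique∧set⇒bag)
import Data.List.Membership.DecPropositional as DecMembership
open import Data.List.Relation.Binary.BagAndSetEquality using (∼bag⇒↭)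
open import Data.List.Relation.Binary.Disjoint.Propositional using (Disjoint)
import Data.List.Relation.Binary.Permutation.Propositional as Perm
open Perm using (_↭_; ↭-sym; ↭-reflexive)
open import Data.List.Relation.Binary.Permutation.Propositional.Properties using (++⁺ˡ; ∈-resp-↭)
open import Data.List.Relation.Unary.Any as Any using (here; there)
open import Data.List.Relation.Unary.All as All using (All; []; _∷_)
open import Data.List.Relation.Unary.AllPairs as AllPairs using (AllPairs; []; _∷_)
open import Data.List.Relation.Unary.Linked using ([])
import Data.List.Relation.Unary.Linked.Properties as Linked
open import Data.List.Relation.Unary.Unique.Propositional using (Unique)
import Data.List.Relation.Unary.Unique.Propositional.Properties as Unique
open import Data.Product using (Σ; _×_; _,_; proj₁; proj₂)
open import Data.Sum using (_⊎_; inj₁; inj₂)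
import Data.Sum as Sum
open import Function using (case_of_)
open import Function.Bundles using (_⇔_; mk⇔)
open import Relation.Nullary using (¬?)
open import Relation.Binary using (Setoid; IsEquivalence; IsStrictTotalOrder; tri<; tri≈; tri>)
open import Relation.Binary.PropositionalEquality using (_≡_; refl; sym; trans; cong; cong₂; subst)
import Relation.Binary.Reasoning.Setoid as SetoidReasoning

module MarkovReasoning {o ℓ e : Level} (C : MarkovCategory o ℓ e) where
  open MarkovCategory C

  homSetoid : Ob → Ob → Setoid ℓ e
  homSetoid A B = record { Carrier = Hom A B ; _≈_ = _≈_ ; isEquivalence = ≈-equiv }

  module ≈ {A B : Ob} = IsEquivalence (≈-equiv {A} {B})
  module HomReasoning {A B : Ob} = SetoidReasoning (homSetoid A B)
  open HomReasoning public

  infixr 4 _⟩∘⟨_ _⟩⊗⟨_ refl⟩∘⟨_ _⟩∘⟨refl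

  _⟩∘⟨_ : ∀ {A B D} {f f' : Hom B D} {g g' : Hom A B} → f ≈ f' → g ≈ g' → f ∘ g ≈ f' ∘ g'
  _⟩∘⟨_ = ∘-resp-≈

  _⟩⊗⟨_ : ∀ {A B D E} {f f' : Hom A B} {g g' : Hom D E} → f ≈ f' → g ≈ g' → f ⊗₁ g ≈ f' ⊗₁ g'
  _⟩⊗⟨_ = ⊗-resp-≈

  refl⟩∘⟨_ : ∀ {A B D} {f : Hom B D} {g g' : Hom A B} → g ≈ g' → f ∘ g ≈ f ∘ g'
  refl⟩∘⟨ p = ≈.refl ⟩∘⟨ p

  _⟩∘⟨refl : ∀ {A B D} {f f' : Hom B D} {g : Hom A B} → f ≈ f' → f ∘ g ≈ f' ∘ g
  p ⟩∘⟨refl = p ⟩∘⟨ ≈.refl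

  ⟨_,_⟩ : ∀ {A B D} → Hom A B → Hom A D → Hom A (B ⊗₀ D)
  ⟨ f , g ⟩ = (f ⊗₁ g) ∘ copy

  sym-assoc : ∀ {A B D E} {f : Hom A B} {g : Hom B D} {h : Hom D E} → h ∘ (g ∘ f) ≈ (h ∘ g) ∘ f
  sym-assoc = ≈.sym assoc

  cancelˡ : ∀ {A B D} {i : Hom B D} {j : Hom D B} {f : Hom A B} → j ∘ i ≈ id → j ∘ (i ∘ f) ≈ f
  cancelˡ p = ≈.trans sym-assoc (≈.trans (p ⟩∘⟨refl) identityˡ)

  pullˡ : ∀ {A B D E} {f : Hom D E} {g : Hom B D} {h : Hom B E} {k : Hom A B} →
          f ∘ g ≈ h → f ∘ (g ∘ k) ≈ h ∘ k
  pullˡ p = ≈.trans sym-assoc (p ⟩∘⟨refl)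

  slide : ∀ {A B D E F} {f : Hom D E} {g : Hom B D} {h₁ : Hom F E} {h₂ : Hom B F} {k : Hom A B} →
          f ∘ g ≈ h₁ ∘ h₂ → f ∘ (g ∘ k) ≈ h₁ ∘ (h₂ ∘ k)
  slide p = ≈.trans (pullˡ p) assoc

  id⊗∘id⊗ : ∀ {A B D E} {f : Hom D E} {g : Hom B D} → (id {A} ⊗₁ f) ∘ (id ⊗₁ g) ≈ id ⊗₁ (f ∘ g)
  id⊗∘id⊗ = ≈.trans (≈.sym ⊗-∘) (identityˡ ⟩⊗⟨ ≈.refl)

  ⊗id∘⊗id : ∀ {A B D E} {f : Hom D E} {g : Hom B D} → (f ⊗₁ id {A}) ∘ (g ⊗₁ id) ≈ (f ∘ g) ⊗₁ id
  ⊗id∘⊗id = ≈.trans (≈.sym ⊗-∘) (≈.refl ⟩⊗⟨ identityˡ)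

  id⊗-inverse : ∀ {A B D} {f : Hom B D} {g : Hom D B} → g ∘ f ≈ id → (id {A} ⊗₁ g) ∘ (id ⊗₁ f) ≈ id
  id⊗-inverse p = ≈.trans id⊗∘id⊗ (≈.trans (≈.refl ⟩⊗⟨ p) ⊗-id)

  inverse-natural : ∀ {A B A' B'} {i : Hom A B} {j : Hom B A} {i' : Hom A' B'} {j' : Hom B' A'}
                      {f : Hom A A'} {g : Hom B B'} →
                    i ∘ j ≈ id → j' ∘ i' ≈ id → i' ∘ f ≈ g ∘ i → j' ∘ g ≈ f ∘ j
  inverse-natural {i = i} {j} {i'} {j'} {f} {g} ij j'i' nat = begin
    j' ∘ g              ≈⟨ identityʳ ⟨
    (j' ∘ g) ∘ id       ≈⟨ refl⟩∘⟨ ij ⟨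
    (j' ∘ g) ∘ (i ∘ j)  ≈⟨ assoc ⟩
    j' ∘ (g ∘ (i ∘ j))  ≈⟨ refl⟩∘⟨ pullˡ (≈.sym nat) ⟩
    j' ∘ ((i' ∘ f) ∘ j) ≈⟨ refl⟩∘⟨ assoc ⟩
    j' ∘ (i' ∘ (f ∘ j)) ≈⟨ cancelˡ j'i' ⟩
    f ∘ j               ∎

  α⇐-natural : ∀ {A B D A' B' D'} {f : Hom A A'} {g : Hom B B'} {h : Hom D D'} →
               α⇐ ∘ (f ⊗₁ (g ⊗₁ h)) ≈ ((f ⊗₁ g) ⊗₁ h) ∘ α⇐
  α⇐-natural = inverse-natural α-iso₂ α-iso₁ α-natural

  λ⇐-natural : ∀ {A B} {f : Hom A B} → λ⇐ ∘ f ≈ (id ⊗₁ f) ∘ λ⇐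
  λ⇐-natural = inverse-natural λ-iso₂ λ-iso₁ λ-natural

  ρ⇐-natural : ∀ {A B} {f : Hom A B} → ρ⇐ ∘ f ≈ (f ⊗₁ id) ∘ ρ⇐
  ρ⇐-natural = inverse-natural ρ-iso₂ ρ-iso₁ ρ-natural

  σ₁₂ : ∀ {A B T} → Hom (A ⊗₀ (B ⊗₀ T)) (B ⊗₀ (A ⊗₀ T))
  σ₁₂ = α⇒ ∘ (σ ⊗₁ id) ∘ α⇐

  σ₁₂-natural : ∀ {A B T A' B' T'} {f : Hom A A'} {g : Hom B B'} {h : Hom T T'} →
                  σ₁₂ ∘ (f ⊗₁ (g ⊗₁ h)) ≈ (g ⊗₁ (f ⊗₁ h)) ∘ σ₁₂
  σ₁₂-natural {f = f} {g} {h} = begin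
    (α⇒ ∘ (σ ⊗₁ id) ∘ α⇐) ∘ (f ⊗₁ (g ⊗₁ h))   ≈⟨ assoc ⟩
    α⇒ ∘ ((σ ⊗₁ id) ∘ α⇐) ∘ (f ⊗₁ (g ⊗₁ h))   ≈⟨ refl⟩∘⟨ assoc ⟩
    α⇒ ∘ (σ ⊗₁ id) ∘ (α⇐ ∘ (f ⊗₁ (g ⊗₁ h)))   ≈⟨ refl⟩∘⟨ refl⟩∘⟨ α⇐-natural ⟩
    α⇒ ∘ (σ ⊗₁ id) ∘ (((f ⊗₁ g) ⊗₁ h) ∘ α⇐)   ≈⟨ refl⟩∘⟨ sym-assoc ⟩
    α⇒ ∘ ((σ ⊗₁ id) ∘ ((f ⊗₁ g) ⊗₁ h)) ∘ α⇐   ≈⟨ refl⟩∘⟨ ((≈.sym ⊗-∘) ⟩∘⟨refl) ⟩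
    α⇒ ∘ ((σ ∘ (f ⊗₁ g)) ⊗₁ (id ∘ h)) ∘ α⇐
      ≈⟨ refl⟩∘⟨ ((σ-natural ⟩⊗⟨ ≈.trans identityˡ (≈.sym identityʳ)) ⟩∘⟨refl) ⟩
    α⇒ ∘ ((((g ⊗₁ f) ∘ σ)) ⊗₁ (h ∘ id)) ∘ α⇐   ≈⟨ refl⟩∘⟨ (⊗-∘ ⟩∘⟨refl) ⟩
    α⇒ ∘ (((g ⊗₁ f) ⊗₁ h) ∘ (σ ⊗₁ id)) ∘ α⇐   ≈⟨ refl⟩∘⟨ assoc ⟩
    α⇒ ∘ ((g ⊗₁ f) ⊗₁ h) ∘ ((σ ⊗₁ id) ∘ α⇐)   ≈⟨ sym-assoc ⟩
    (α⇒ ∘ ((g ⊗₁ f) ⊗₁ h)) ∘ ((σ ⊗₁ id) ∘ α⇐) ≈⟨ α-natural ⟩∘⟨refl ⟩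
    ((g ⊗₁ (f ⊗₁ h)) ∘ α⇒) ∘ ((σ ⊗₁ id) ∘ α⇐) ≈⟨ assoc ⟩
    (g ⊗₁ (f ⊗₁ h)) ∘ α⇒ ∘ (σ ⊗₁ id) ∘ α⇐ ∎

  σ₁₂-involutive : ∀ {A B T} → σ₁₂ {B} {A} {T} ∘ σ₁₂ {A} {B} {T} ≈ id
  σ₁₂-involutive = begin
    (α⇒ ∘ (σ ⊗₁ id) ∘ α⇐) ∘ (α⇒ ∘ (σ ⊗₁ id) ∘ α⇐)  ≈⟨ assoc ⟩
    α⇒ ∘ ((σ ⊗₁ id) ∘ α⇐) ∘ (α⇒ ∘ (σ ⊗₁ id) ∘ α⇐)  ≈⟨ refl⟩∘⟨ assoc ⟩
    α⇒ ∘ (σ ⊗₁ id) ∘ α⇐ ∘ (α⇒ ∘ (σ ⊗₁ id) ∘ α⇐)    ≈⟨ refl⟩∘⟨ refl⟩∘⟨ cancelˡ α-iso₁ ⟩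
    α⇒ ∘ (σ ⊗₁ id) ∘ ((σ ⊗₁ id) ∘ α⇐)              ≈⟨ refl⟩∘⟨ sym-assoc ⟩
    α⇒ ∘ ((σ ⊗₁ id) ∘ (σ ⊗₁ id)) ∘ α⇐              ≈⟨ refl⟩∘⟨ (⊗id∘⊗id ⟩∘⟨refl) ⟩
    α⇒ ∘ ((σ ∘ σ) ⊗₁ id) ∘ α⇐                      ≈⟨ refl⟩∘⟨ ((σ-involutive ⟩⊗⟨ ≈.refl) ⟩∘⟨refl) ⟩
    α⇒ ∘ (id ⊗₁ id) ∘ α⇐                           ≈⟨ refl⟩∘⟨ (⊗-id ⟩∘⟨refl) ⟩
    α⇒ ∘ id ∘ α⇐                                   ≈⟨ refl⟩∘⟨ identityˡ ⟩
    α⇒ ∘ α⇐                                        ≈⟨ α-iso₂ ⟩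
    id ∎

  σ₁₂-hexagon : ∀ {A B T} → (id {B} ⊗₁ σ {A} {T}) ∘ σ₁₂ ≈ α⇒ ∘ σ {A} {B ⊗₀ T}
  σ₁₂-hexagon = begin
    (id ⊗₁ σ) ∘ α⇒ ∘ (σ ⊗₁ id) ∘ α⇐   ≈⟨ refl⟩∘⟨ sym-assoc ⟩
    (id ⊗₁ σ) ∘ (α⇒ ∘ (σ ⊗₁ id)) ∘ α⇐   ≈⟨ sym-assoc ⟩
    ((id ⊗₁ σ) ∘ (α⇒ ∘ (σ ⊗₁ id))) ∘ α⇐   ≈⟨ hexagon ⟩∘⟨refl ⟩
    (α⇒ ∘ σ ∘ α⇒) ∘ α⇐   ≈⟨ assoc ⟩
    α⇒ ∘ ((σ ∘ α⇒) ∘ α⇐)   ≈⟨ refl⟩∘⟨ assoc ⟩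
    α⇒ ∘ (σ ∘ (α⇒ ∘ α⇐))   ≈⟨ refl⟩∘⟨ refl⟩∘⟨ α-iso₂ ⟩
    α⇒ ∘ (σ ∘ id)   ≈⟨ refl⟩∘⟨ identityʳ ⟩
    α⇒ ∘ σ ∎

  moveLast : ∀ {A D T} → Hom (D ⊗₀ (A ⊗₀ T)) ((D ⊗₀ T) ⊗₀ A)
  moveLast = α⇐ ∘ (id ⊗₁ σ)
  moveSecond : ∀ {A D T} → Hom ((D ⊗₀ T) ⊗₀ A) (D ⊗₀ (A ⊗₀ T))
  moveSecond = (id ⊗₁ σ) ∘ α⇒

  moveSecond∘moveLast : ∀ {A D T} → moveSecond {A} {D} {T} ∘ moveLast ≈ id
  moveSecond∘moveLast = begin
    ((id ⊗₁ σ) ∘ α⇒) ∘ (α⇐ ∘ (id ⊗₁ σ))   ≈⟨ assoc ⟩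
    (id ⊗₁ σ) ∘ (α⇒ ∘ (α⇐ ∘ (id ⊗₁ σ)))   ≈⟨ refl⟩∘⟨ cancelˡ α-iso₂ ⟩
    (id ⊗₁ σ) ∘ (id ⊗₁ σ)   ≈⟨ id⊗∘id⊗ ⟩
    id ⊗₁ (σ ∘ σ)   ≈⟨ ≈.refl ⟩⊗⟨ σ-involutive ⟩
    id ⊗₁ id   ≈⟨ ⊗-id ⟩
    id ∎

  moveLast∘σ₁₂ : ∀ {A D T} → moveLast ∘ σ₁₂ {A} {D} {T} ≈ σ
  moveLast∘σ₁₂ = begin
    (α⇐ ∘ (id ⊗₁ σ)) ∘ σ₁₂   ≈⟨ assoc ⟩
    α⇐ ∘ ((id ⊗₁ σ) ∘ σ₁₂)   ≈⟨ refl⟩∘⟨ σ₁₂-hexagon ⟩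
    α⇐ ∘ (α⇒ ∘ σ)   ≈⟨ cancelˡ α-iso₁ ⟩
    σ ∎

  σ₁₂-twice : ∀ {A B D T} → (id {B} ⊗₁ σ₁₂ {A} {D} {T}) ∘ σ₁₂ ≈ (id ⊗₁ moveSecond) ∘ α⇒ ∘ σ
  σ₁₂-twice = begin
    (id ⊗₁ σ₁₂) ∘ σ₁₂   ≈⟨ identityˡ ⟨
    id ∘ ((id ⊗₁ σ₁₂) ∘ σ₁₂)   ≈⟨ (≈.trans (≈.refl ⟩⊗⟨ moveSecond∘moveLast) ⊗-id) ⟩∘⟨refl ⟨
    (id ⊗₁ (moveSecond ∘ moveLast)) ∘ ((id ⊗₁ σ₁₂) ∘ σ₁₂)   ≈⟨ id⊗∘id⊗ ⟩∘⟨refl ⟨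
    ((id ⊗₁ moveSecond) ∘ (id ⊗₁ moveLast)) ∘ ((id ⊗₁ σ₁₂) ∘ σ₁₂)   ≈⟨ assoc ⟩
    (id ⊗₁ moveSecond) ∘ ((id ⊗₁ moveLast) ∘ ((id ⊗₁ σ₁₂) ∘ σ₁₂))   ≈⟨ refl⟩∘⟨ pullˡ id⊗∘id⊗ ⟩
    (id ⊗₁ moveSecond) ∘ ((id ⊗₁ (moveLast ∘ σ₁₂)) ∘ σ₁₂)   ≈⟨ refl⟩∘⟨ ((≈.refl ⟩⊗⟨ moveLast∘σ₁₂) ⟩∘⟨refl) ⟩
    (id ⊗₁ moveSecond) ∘ ((id ⊗₁ σ) ∘ σ₁₂)   ≈⟨ refl⟩∘⟨ σ₁₂-hexagon ⟩
    (id ⊗₁ moveSecond) ∘ α⇒ ∘ σ ∎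

  pentagon′ : ∀ {A B D E} → α⇐ ∘ (id ⊗₁ α⇒) ∘ α⇒ ≈ α⇒ ∘ (α⇐ {A} {B} {D} ⊗₁ id {E})
  pentagon′ = begin
    α⇐ ∘ (id ⊗₁ α⇒) ∘ α⇒   ≈⟨ refl⟩∘⟨ identityʳ ⟨
    α⇐ ∘ ((id ⊗₁ α⇒) ∘ α⇒) ∘ id   ≈⟨ refl⟩∘⟨ refl⟩∘⟨ ≈.trans ⊗id∘⊗id (≈.trans (α-iso₂ ⟩⊗⟨ ≈.refl) ⊗-id) ⟨
    α⇐ ∘ ((id ⊗₁ α⇒) ∘ α⇒) ∘ ((α⇒ ⊗₁ id) ∘ (α⇐ ⊗₁ id))   ≈⟨ refl⟩∘⟨ assoc ⟩
    α⇐ ∘ (id ⊗₁ α⇒) ∘ (α⇒ ∘ ((α⇒ ⊗₁ id) ∘ (α⇐ ⊗₁ id)))   ≈⟨ refl⟩∘⟨ refl⟩∘⟨ sym-assoc ⟩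
    α⇐ ∘ (id ⊗₁ α⇒) ∘ ((α⇒ ∘ (α⇒ ⊗₁ id)) ∘ (α⇐ ⊗₁ id))   ≈⟨ refl⟩∘⟨ sym-assoc ⟩
    α⇐ ∘ ((id ⊗₁ α⇒) ∘ (α⇒ ∘ (α⇒ ⊗₁ id))) ∘ (α⇐ ⊗₁ id)   ≈⟨ refl⟩∘⟨ (pentagon ⟩∘⟨refl) ⟩
    α⇐ ∘ (α⇒ ∘ α⇒) ∘ (α⇐ ⊗₁ id)   ≈⟨ refl⟩∘⟨ assoc ⟩
    α⇐ ∘ α⇒ ∘ α⇒ ∘ (α⇐ ⊗₁ id)   ≈⟨ cancelˡ α-iso₁ ⟩
    α⇒ ∘ (α⇐ ⊗₁ id) ∎

  σ₁₂-pentagon : ∀ {B D T A} → σ₁₂ ∘ (id ⊗₁ α⇒) ∘ α⇒ ≈ (id ⊗₁ α⇒) ∘ α⇒ ∘ (σ₁₂ {B} {D} {T} ⊗₁ id {A})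
  σ₁₂-pentagon = begin
    (α⇒ ∘ (σ ⊗₁ id) ∘ α⇐) ∘ (id ⊗₁ α⇒) ∘ α⇒   ≈⟨ assoc ⟩
    α⇒ ∘ ((σ ⊗₁ id) ∘ α⇐) ∘ (id ⊗₁ α⇒) ∘ α⇒   ≈⟨ refl⟩∘⟨ assoc ⟩
    α⇒ ∘ (σ ⊗₁ id) ∘ α⇐ ∘ (id ⊗₁ α⇒) ∘ α⇒   ≈⟨ refl⟩∘⟨ refl⟩∘⟨ pentagon′ ⟩
    α⇒ ∘ (σ ⊗₁ id) ∘ α⇒ ∘ (α⇐ ⊗₁ id)   ≈⟨ refl⟩∘⟨ sym-assoc ⟩
    α⇒ ∘ ((σ ⊗₁ id) ∘ α⇒) ∘ (α⇐ ⊗₁ id)   ≈⟨ refl⟩∘⟨ (((≈.refl ⟩⊗⟨ ⊗-id) ⟩∘⟨refl) ⟩∘⟨refl) ⟨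
    α⇒ ∘ ((σ ⊗₁ (id ⊗₁ id)) ∘ α⇒) ∘ (α⇐ ⊗₁ id)   ≈⟨ refl⟩∘⟨ (α-natural ⟩∘⟨refl) ⟨
    α⇒ ∘ (α⇒ ∘ ((σ ⊗₁ id) ⊗₁ id)) ∘ (α⇐ ⊗₁ id)   ≈⟨ refl⟩∘⟨ assoc ⟩
    α⇒ ∘ α⇒ ∘ ((σ ⊗₁ id) ⊗₁ id) ∘ (α⇐ ⊗₁ id)   ≈⟨ sym-assoc ⟩
    (α⇒ ∘ α⇒) ∘ ((σ ⊗₁ id) ⊗₁ id) ∘ (α⇐ ⊗₁ id)   ≈⟨ pentagon ⟩∘⟨refl ⟨
    ((id ⊗₁ α⇒) ∘ α⇒ ∘ (α⇒ ⊗₁ id)) ∘ ((σ ⊗₁ id) ⊗₁ id) ∘ (α⇐ ⊗₁ id)   ≈⟨ assoc ⟩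
    (id ⊗₁ α⇒) ∘ (α⇒ ∘ (α⇒ ⊗₁ id)) ∘ ((σ ⊗₁ id) ⊗₁ id) ∘ (α⇐ ⊗₁ id)   ≈⟨ refl⟩∘⟨ assoc ⟩
    (id ⊗₁ α⇒) ∘ α⇒ ∘ (α⇒ ⊗₁ id) ∘ ((σ ⊗₁ id) ⊗₁ id) ∘ (α⇐ ⊗₁ id)   ≈⟨ refl⟩∘⟨ refl⟩∘⟨ refl⟩∘⟨ ⊗id∘⊗id ⟩
    (id ⊗₁ α⇒) ∘ α⇒ ∘ (α⇒ ⊗₁ id) ∘ (((σ ⊗₁ id) ∘ α⇐) ⊗₁ id)   ≈⟨ refl⟩∘⟨ refl⟩∘⟨ ⊗id∘⊗id ⟩
    (id ⊗₁ α⇒) ∘ α⇒ ∘ ((α⇒ ∘ (σ ⊗₁ id) ∘ α⇐) ⊗₁ id) ∎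

  σ₁₂-braid : ∀ {A B D T} → σ₁₂ ∘ (id ⊗₁ σ₁₂) ∘ σ₁₂ {A} {B} {D ⊗₀ T}
                      ≈ (id ⊗₁ σ₁₂) ∘ σ₁₂ ∘ (id ⊗₁ σ₁₂)
  σ₁₂-braid = begin
    σ₁₂ ∘ (id ⊗₁ σ₁₂) ∘ σ₁₂   ≈⟨ refl⟩∘⟨ σ₁₂-twice ⟩
    σ₁₂ ∘ (id ⊗₁ moveSecond) ∘ α⇒ ∘ σ   ≈⟨ refl⟩∘⟨ (id⊗∘id⊗ ⟩∘⟨refl) ⟨
    σ₁₂ ∘ ((id ⊗₁ (id ⊗₁ σ)) ∘ (id ⊗₁ α⇒)) ∘ α⇒ ∘ σ   ≈⟨ refl⟩∘⟨ assoc ⟩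
    σ₁₂ ∘ (id ⊗₁ (id ⊗₁ σ)) ∘ (id ⊗₁ α⇒) ∘ α⇒ ∘ σ   ≈⟨ sym-assoc ⟩
    (σ₁₂ ∘ (id ⊗₁ (id ⊗₁ σ))) ∘ (id ⊗₁ α⇒) ∘ α⇒ ∘ σ   ≈⟨ σ₁₂-natural ⟩∘⟨refl ⟩
    ((id ⊗₁ (id ⊗₁ σ)) ∘ σ₁₂) ∘ (id ⊗₁ α⇒) ∘ α⇒ ∘ σ   ≈⟨ assoc ⟩
    (id ⊗₁ (id ⊗₁ σ)) ∘ σ₁₂ ∘ (id ⊗₁ α⇒) ∘ α⇒ ∘ σ   ≈⟨ refl⟩∘⟨ refl⟩∘⟨ sym-assoc ⟩
    (id ⊗₁ (id ⊗₁ σ)) ∘ σ₁₂ ∘ ((id ⊗₁ α⇒) ∘ α⇒) ∘ σ   ≈⟨ refl⟩∘⟨ sym-assoc ⟩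
    (id ⊗₁ (id ⊗₁ σ)) ∘ (σ₁₂ ∘ (id ⊗₁ α⇒) ∘ α⇒) ∘ σ   ≈⟨ refl⟩∘⟨ (σ₁₂-pentagon ⟩∘⟨refl) ⟩
    (id ⊗₁ (id ⊗₁ σ)) ∘ ((id ⊗₁ α⇒) ∘ α⇒ ∘ (σ₁₂ ⊗₁ id)) ∘ σ   ≈⟨ refl⟩∘⟨ assoc ⟩
    (id ⊗₁ (id ⊗₁ σ)) ∘ (id ⊗₁ α⇒) ∘ (α⇒ ∘ (σ₁₂ ⊗₁ id)) ∘ σ   ≈⟨ refl⟩∘⟨ refl⟩∘⟨ assoc ⟩
    (id ⊗₁ (id ⊗₁ σ)) ∘ (id ⊗₁ α⇒) ∘ α⇒ ∘ (σ₁₂ ⊗₁ id) ∘ σ   ≈⟨ refl⟩∘⟨ refl⟩∘⟨ refl⟩∘⟨ σ-natural ⟨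
    (id ⊗₁ (id ⊗₁ σ)) ∘ (id ⊗₁ α⇒) ∘ α⇒ ∘ σ ∘ (id ⊗₁ σ₁₂)   ≈⟨ sym-assoc ⟩
    ((id ⊗₁ (id ⊗₁ σ)) ∘ (id ⊗₁ α⇒)) ∘ α⇒ ∘ σ ∘ (id ⊗₁ σ₁₂)   ≈⟨ id⊗∘id⊗ ⟩∘⟨refl ⟩
    (id ⊗₁ moveSecond) ∘ α⇒ ∘ σ ∘ (id ⊗₁ σ₁₂)   ≈⟨ refl⟩∘⟨ sym-assoc ⟩
    (id ⊗₁ moveSecond) ∘ (α⇒ ∘ σ) ∘ (id ⊗₁ σ₁₂)   ≈⟨ sym-assoc ⟩
    ((id ⊗₁ moveSecond) ∘ (α⇒ ∘ σ)) ∘ (id ⊗₁ σ₁₂)   ≈⟨ σ₁₂-twice ⟩∘⟨refl ⟨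
    ((id ⊗₁ σ₁₂) ∘ σ₁₂) ∘ (id ⊗₁ σ₁₂)   ≈⟨ assoc ⟩
    (id ⊗₁ σ₁₂) ∘ σ₁₂ ∘ (id ⊗₁ σ₁₂) ∎

  σ₁₂-slide : ∀ {X P Q R S T} {f : Hom R (S ⊗₀ T)} {g : Hom P (Q ⊗₀ R)} →
              (id {Q} ⊗₁ (σ₁₂ ∘ (id {X} ⊗₁ f))) ∘ (σ₁₂ ∘ (id ⊗₁ g)) ≈ (id ⊗₁ σ₁₂) ∘ σ₁₂ ∘ (id ⊗₁ ((id ⊗₁ f) ∘ g))
  σ₁₂-slide {f = f} {g} = begin
    (id ⊗₁ (σ₁₂ ∘ (id ⊗₁ f))) ∘ (σ₁₂ ∘ (id ⊗₁ g))             ≈⟨ id⊗∘id⊗ ⟩∘⟨refl ⟨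
    ((id ⊗₁ σ₁₂) ∘ (id ⊗₁ (id ⊗₁ f))) ∘ (σ₁₂ ∘ (id ⊗₁ g))     ≈⟨ assoc ⟩
    (id ⊗₁ σ₁₂) ∘ (id ⊗₁ (id ⊗₁ f)) ∘ σ₁₂ ∘ (id ⊗₁ g)         ≈⟨ refl⟩∘⟨ pullˡ (≈.sym σ₁₂-natural) ⟩
    (id ⊗₁ σ₁₂) ∘ (σ₁₂ ∘ (id ⊗₁ (id ⊗₁ f))) ∘ (id ⊗₁ g)       ≈⟨ refl⟩∘⟨ assoc ⟩
    (id ⊗₁ σ₁₂) ∘ σ₁₂ ∘ (id ⊗₁ (id ⊗₁ f)) ∘ (id ⊗₁ g)         ≈⟨ refl⟩∘⟨ refl⟩∘⟨ id⊗∘id⊗ ⟩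
    (id ⊗₁ σ₁₂) ∘ σ₁₂ ∘ (id ⊗₁ ((id ⊗₁ f) ∘ g))               ∎

  ⊗id-cancel : ∀ {A B} {f g : Hom A B} → f ⊗₁ id {I} ≈ g ⊗₁ id → f ≈ g
  ⊗id-cancel {f = f} {g} p = begin
    f   ≈⟨ identityʳ ⟨
    f ∘ id   ≈⟨ refl⟩∘⟨ ρ-iso₂ ⟨
    f ∘ (ρ⇒ ∘ ρ⇐)   ≈⟨ sym-assoc ⟩
    (f ∘ ρ⇒) ∘ ρ⇐   ≈⟨ ρ-natural ⟩∘⟨refl ⟨
    (ρ⇒ ∘ (f ⊗₁ id)) ∘ ρ⇐   ≈⟨ (refl⟩∘⟨ p) ⟩∘⟨refl ⟩
    (ρ⇒ ∘ (g ⊗₁ id)) ∘ ρ⇐   ≈⟨ ρ-natural ⟩∘⟨refl ⟩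
    (g ∘ ρ⇒) ∘ ρ⇐   ≈⟨ assoc ⟩
    g ∘ (ρ⇒ ∘ ρ⇐)   ≈⟨ refl⟩∘⟨ ρ-iso₂ ⟩
    g ∘ id   ≈⟨ identityʳ ⟩
    g ∎

  kelly-ρ⇒ : ∀ {A B} → (id {A} ⊗₁ ρ⇒ {B}) ∘ α⇒ ≈ ρ⇒ {A ⊗₀ B}
  kelly-ρ⇒ {A} {B} = ⊗id-cancel (begin
    ((id ⊗₁ ρ⇒) ∘ α⇒) ⊗₁ id   ≈⟨ cancelˡ α-iso₁ ⟨
    α⇐ ∘ (α⇒ ∘ (((id ⊗₁ ρ⇒) ∘ α⇒) ⊗₁ id))   ≈⟨ refl⟩∘⟨ step ⟩
    α⇐ ∘ (α⇒ ∘ (ρ⇒ ⊗₁ id))   ≈⟨ cancelˡ α-iso₁ ⟩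
    ρ⇒ ⊗₁ id ∎)
    where
    step : α⇒ ∘ (((id ⊗₁ ρ⇒) ∘ α⇒) ⊗₁ id) ≈ α⇒ ∘ (ρ⇒ {A ⊗₀ B} ⊗₁ id {I})
    step = begin
      α⇒ ∘ (((id ⊗₁ ρ⇒) ∘ α⇒) ⊗₁ id)   ≈⟨ refl⟩∘⟨ ≈.sym ⊗id∘⊗id ⟩
      α⇒ ∘ (((id ⊗₁ ρ⇒) ⊗₁ id) ∘ (α⇒ ⊗₁ id))   ≈⟨ sym-assoc ⟩
      (α⇒ ∘ ((id ⊗₁ ρ⇒) ⊗₁ id)) ∘ (α⇒ ⊗₁ id)   ≈⟨ α-natural ⟩∘⟨refl ⟩
      ((id ⊗₁ (ρ⇒ ⊗₁ id)) ∘ α⇒) ∘ (α⇒ ⊗₁ id)   ≈⟨ ((≈.refl ⟩⊗⟨ triangle) ⟩∘⟨refl) ⟩∘⟨refl ⟨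
      ((id ⊗₁ ((id ⊗₁ λ⇒) ∘ α⇒)) ∘ α⇒) ∘ (α⇒ ⊗₁ id)   ≈⟨ (id⊗∘id⊗ ⟩∘⟨refl) ⟩∘⟨refl ⟨
      (((id ⊗₁ (id ⊗₁ λ⇒)) ∘ (id ⊗₁ α⇒)) ∘ α⇒) ∘ (α⇒ ⊗₁ id)   ≈⟨ assoc ⟩∘⟨refl ⟩
      ((id ⊗₁ (id ⊗₁ λ⇒)) ∘ ((id ⊗₁ α⇒) ∘ α⇒)) ∘ (α⇒ ⊗₁ id)   ≈⟨ assoc ⟩
      (id ⊗₁ (id ⊗₁ λ⇒)) ∘ (((id ⊗₁ α⇒) ∘ α⇒) ∘ (α⇒ ⊗₁ id))   ≈⟨ refl⟩∘⟨ assoc ⟩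
      (id ⊗₁ (id ⊗₁ λ⇒)) ∘ ((id ⊗₁ α⇒) ∘ α⇒ ∘ (α⇒ ⊗₁ id))   ≈⟨ refl⟩∘⟨ pentagon ⟩
      (id ⊗₁ (id ⊗₁ λ⇒)) ∘ (α⇒ ∘ α⇒)   ≈⟨ sym-assoc ⟩
      ((id ⊗₁ (id ⊗₁ λ⇒)) ∘ α⇒) ∘ α⇒   ≈⟨ α-natural ⟩∘⟨refl ⟨
      (α⇒ ∘ ((id ⊗₁ id) ⊗₁ λ⇒)) ∘ α⇒   ≈⟨ assoc ⟩
      α⇒ ∘ (((id ⊗₁ id) ⊗₁ λ⇒) ∘ α⇒)   ≈⟨ refl⟩∘⟨ ((⊗-id ⟩⊗⟨ ≈.refl) ⟩∘⟨refl) ⟩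
      α⇒ ∘ ((id ⊗₁ λ⇒) ∘ α⇒)   ≈⟨ refl⟩∘⟨ triangle ⟩
      α⇒ ∘ (ρ⇒ ⊗₁ id) ∎

  α⇒∘ρ⇐ : ∀ {A B} → α⇒ ∘ ρ⇐ {A ⊗₀ B} ≈ id ⊗₁ ρ⇐
  α⇒∘ρ⇐ = begin
    α⇒ ∘ ρ⇐   ≈⟨ identityˡ ⟨
    id ∘ (α⇒ ∘ ρ⇐)   ≈⟨ id⊗-inverse ρ-iso₁ ⟩∘⟨refl ⟨
    ((id ⊗₁ ρ⇐) ∘ (id ⊗₁ ρ⇒)) ∘ (α⇒ ∘ ρ⇐)   ≈⟨ assoc ⟩
    (id ⊗₁ ρ⇐) ∘ ((id ⊗₁ ρ⇒) ∘ (α⇒ ∘ ρ⇐))   ≈⟨ refl⟩∘⟨ pullˡ kelly-ρ⇒ ⟩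
    (id ⊗₁ ρ⇐) ∘ (ρ⇒ ∘ ρ⇐)   ≈⟨ refl⟩∘⟨ ρ-iso₂ ⟩
    (id ⊗₁ ρ⇐) ∘ id   ≈⟨ identityʳ ⟩
    id ⊗₁ ρ⇐ ∎

  ρ⇐≈λ⇐ : ρ⇐ {I} ≈ λ⇐
  ρ⇐≈λ⇐ = begin
    ρ⇐   ≈⟨ copy-counitʳ ⟨
    (id ⊗₁ del) ∘ copy   ≈⟨ (≈.refl ⟩⊗⟨ del-I) ⟩∘⟨ copy-I ⟩
    (id ⊗₁ id) ∘ λ⇐   ≈⟨ ⊗-id ⟩∘⟨refl ⟩
    id ∘ λ⇐   ≈⟨ identityˡ ⟩
    λ⇐ ∎

  del-unique : ∀ {A} (x : Hom A I) → x ≈ del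
  del-unique x = ≈.trans (≈.sym identityˡ) (≈.trans (≈.sym del-I ⟩∘⟨refl) del-natural)

  ⊗del∘copy : ∀ {A B} {f : Hom A B} {g : Hom A I} → (f ⊗₁ g) ∘ copy ≈ ρ⇐ ∘ f
  ⊗del∘copy {f = f} {g} = begin
    (f ⊗₁ g) ∘ copy   ≈⟨ (≈.refl ⟩⊗⟨ del-unique g) ⟩∘⟨refl ⟩
    (f ⊗₁ del) ∘ copy   ≈⟨ (≈.trans (≈.sym ⊗-∘) (identityʳ ⟩⊗⟨ identityˡ)) ⟩∘⟨refl ⟨
    ((f ⊗₁ id) ∘ (id ⊗₁ del)) ∘ copy   ≈⟨ assoc ⟩
    (f ⊗₁ id) ∘ ((id ⊗₁ del) ∘ copy)   ≈⟨ refl⟩∘⟨ copy-counitʳ ⟩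
    (f ⊗₁ id) ∘ ρ⇐   ≈⟨ ρ⇐-natural ⟨
    ρ⇐ ∘ f ∎

module Coherence {o ℓ e : Level} (𝒱 : VarStructure) (C : MarkovCategory o ℓ e)
                 (θ : VarStructure.Var 𝒱 → MarkovCategory.Ob C) where
  open Theory 𝒱 C θ
  open MarkovReasoning C

  -- Pick y xs r: removing one occurrence of y from xs leaves r, and pick brings that wire to the front.
  -- A Sel xs ys lists ys by successive picks: a normal form of permutations, unique when xs is duplicate-free.
  data Pick (y : Var) : List Var → List Var → Set where
    here : ∀ {xs} → Pick y (y ∷ xs) xs
    there : ∀ {x xs r} → Pick y xs r → Pick y (x ∷ xs) (x ∷ r)

  pick : ∀ {y xs r} → Pick y xs r → Hom ⟦ xs ⟧ (θ y ⊗₀ ⟦ r ⟧)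
  pick here = id
  pick (there a) = σ₁₂ ∘ (id ⊗₁ pick a)

  data Sel : List Var → List Var → Set where
    [] : Sel [] []
    _∷_ : ∀ {y xs r ys} → Pick y xs r → Sel r ys → Sel xs (y ∷ ys)

  canonical : ∀ {xs ys} → Sel xs ys → Hom ⟦ xs ⟧ ⟦ ys ⟧
  canonical [] = id
  canonical (a ∷ s) = (id ⊗₁ canonical s) ∘ pick a

  pick-pick : ∀ {y z xs r₁ r₂} (a : Pick y xs r₁) (b : Pick z r₁ r₂) →
         Σ (List Var) λ r' → Σ (Pick z xs r') λ a' → Σ (Pick y r' r₂) λ b' →
           σ₁₂ ∘ (id ⊗₁ pick b) ∘ pick a ≈ (id ⊗₁ pick b') ∘ pick a'
  pick-pick here b = _ , there b , here , (begin
    σ₁₂ ∘ (id ⊗₁ pick b) ∘ id   ≈⟨ refl⟩∘⟨ identityʳ ⟩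
    σ₁₂ ∘ (id ⊗₁ pick b)   ≈⟨ identityˡ ⟨
    id ∘ (σ₁₂ ∘ (id ⊗₁ pick b))   ≈⟨ ⊗-id ⟩∘⟨refl ⟨
    (id ⊗₁ id) ∘ (σ₁₂ ∘ (id ⊗₁ pick b)) ∎)
  pick-pick (there a) here = _ , here , a , (begin
    σ₁₂ ∘ (id ⊗₁ id) ∘ (σ₁₂ ∘ (id ⊗₁ pick a))   ≈⟨ refl⟩∘⟨ (⊗-id ⟩∘⟨refl) ⟩
    σ₁₂ ∘ id ∘ (σ₁₂ ∘ (id ⊗₁ pick a))   ≈⟨ refl⟩∘⟨ identityˡ ⟩
    σ₁₂ ∘ (σ₁₂ ∘ (id ⊗₁ pick a))   ≈⟨ cancelˡ σ₁₂-involutive ⟩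
    id ⊗₁ pick a   ≈⟨ identityʳ ⟨
    (id ⊗₁ pick a) ∘ id ∎)
  pick-pick (there a) (there b) with pick-pick a b
  ... | _ , a' , b' , eq = _ , there a' , there b' , (begin
    σ₁₂ ∘ (id ⊗₁ (σ₁₂ ∘ (id ⊗₁ pick b))) ∘ (σ₁₂ ∘ (id ⊗₁ pick a))     ≈⟨ refl⟩∘⟨ σ₁₂-slide ⟩
    σ₁₂ ∘ (id ⊗₁ σ₁₂) ∘ σ₁₂ ∘ (id ⊗₁ ((id ⊗₁ pick b) ∘ pick a))
      ≈⟨ ≈.trans (refl⟩∘⟨ sym-assoc) (≈.trans sym-assoc (σ₁₂-braid ⟩∘⟨refl)) ⟩
    ((id ⊗₁ σ₁₂) ∘ σ₁₂ ∘ (id ⊗₁ σ₁₂)) ∘ (id ⊗₁ ((id ⊗₁ pick b) ∘ pick a))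
      ≈⟨ ≈.trans assoc (refl⟩∘⟨ ≈.trans assoc (refl⟩∘⟨ id⊗∘id⊗)) ⟩
    (id ⊗₁ σ₁₂) ∘ σ₁₂ ∘ (id ⊗₁ (σ₁₂ ∘ (id ⊗₁ pick b) ∘ pick a))       ≈⟨ refl⟩∘⟨ refl⟩∘⟨ (≈.refl ⟩⊗⟨ eq) ⟩
    (id ⊗₁ σ₁₂) ∘ σ₁₂ ∘ (id ⊗₁ ((id ⊗₁ pick b') ∘ pick a'))           ≈⟨ σ₁₂-slide ⟨
    (id ⊗₁ (σ₁₂ ∘ (id ⊗₁ pick b'))) ∘ (σ₁₂ ∘ (id ⊗₁ pick a'))          ∎)

  pick∘canonical : ∀ {xs ys z ys'} (s : Sel xs ys) (j : Pick z ys ys') →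
     Σ (List Var) λ xs' → Σ (Pick z xs xs') λ i → Σ (Sel xs' ys') λ s' →
       pick j ∘ canonical s ≈ (id ⊗₁ canonical s') ∘ pick i
  pick∘canonical (a ∷ s) here = _ , a , s , identityˡ
  pick∘canonical (a ∷ s) (there j) with pick∘canonical s j
  ... | r' , i₀ , s₀' , eq with pick-pick a i₀
  ... | r'' , i , a' , eq2 = r'' , i , (a' ∷ s₀') , (begin
    (σ₁₂ ∘ (id ⊗₁ pick j)) ∘ ((id ⊗₁ canonical s) ∘ pick a)   ≈⟨ assoc ⟩
    σ₁₂ ∘ (id ⊗₁ pick j) ∘ ((id ⊗₁ canonical s) ∘ pick a)   ≈⟨ refl⟩∘⟨ pullˡ id⊗∘id⊗ ⟩
    σ₁₂ ∘ (id ⊗₁ (pick j ∘ canonical s)) ∘ pick a   ≈⟨ refl⟩∘⟨ ((≈.refl ⟩⊗⟨ eq) ⟩∘⟨refl) ⟩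
    σ₁₂ ∘ (id ⊗₁ ((id ⊗₁ canonical s₀') ∘ pick i₀)) ∘ pick a   ≈⟨ refl⟩∘⟨ (id⊗∘id⊗ ⟩∘⟨refl) ⟨
    σ₁₂ ∘ ((id ⊗₁ (id ⊗₁ canonical s₀')) ∘ (id ⊗₁ pick i₀)) ∘ pick a   ≈⟨ refl⟩∘⟨ assoc ⟩
    σ₁₂ ∘ (id ⊗₁ (id ⊗₁ canonical s₀')) ∘ (id ⊗₁ pick i₀) ∘ pick a   ≈⟨ sym-assoc ⟩
    (σ₁₂ ∘ (id ⊗₁ (id ⊗₁ canonical s₀'))) ∘ (id ⊗₁ pick i₀) ∘ pick a   ≈⟨ σ₁₂-natural ⟩∘⟨refl ⟩
    ((id ⊗₁ (id ⊗₁ canonical s₀')) ∘ σ₁₂) ∘ (id ⊗₁ pick i₀) ∘ pick a   ≈⟨ assoc ⟩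
    (id ⊗₁ (id ⊗₁ canonical s₀')) ∘ σ₁₂ ∘ (id ⊗₁ pick i₀) ∘ pick a   ≈⟨ refl⟩∘⟨ eq2 ⟩
    (id ⊗₁ (id ⊗₁ canonical s₀')) ∘ (id ⊗₁ pick a') ∘ pick i   ≈⟨ pullˡ id⊗∘id⊗ ⟩
    (id ⊗₁ ((id ⊗₁ canonical s₀') ∘ pick a')) ∘ pick i ∎)

  _⨾_ : ∀ {xs ys zs} → Sel xs ys → Sel ys zs → Sel xs zs
  s ⨾ [] = s
  s ⨾ (j ∷ t) with pick∘canonical s j
  ... | _ , i , s' , _ = i ∷ (s' ⨾ t)

  canonical-⨾ : ∀ {xs ys zs} (s : Sel xs ys) (t : Sel ys zs) → canonical (s ⨾ t) ≈ canonical t ∘ canonical s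
  canonical-⨾ s [] = ≈.sym identityˡ
  canonical-⨾ s (j ∷ t) with pick∘canonical s j
  ... | _ , i , s' , eq = begin
    (id ⊗₁ canonical (s' ⨾ t)) ∘ pick i               ≈⟨ (≈.refl ⟩⊗⟨ canonical-⨾ s' t) ⟩∘⟨refl ⟩
    (id ⊗₁ (canonical t ∘ canonical s')) ∘ pick i      ≈⟨ id⊗∘id⊗ ⟩∘⟨refl ⟨
    ((id ⊗₁ canonical t) ∘ (id ⊗₁ canonical s')) ∘ pick i ≈⟨ assoc ⟩
    (id ⊗₁ canonical t) ∘ (id ⊗₁ canonical s') ∘ pick i ≈⟨ refl⟩∘⟨ eq ⟨
    (id ⊗₁ canonical t) ∘ pick j ∘ canonical s         ≈⟨ sym-assoc ⟩
    ((id ⊗₁ canonical t) ∘ pick j) ∘ canonical s       ∎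

  Sel-id : ∀ xs → Sel xs xs
  Sel-id [] = []
  Sel-id (x ∷ xs) = here ∷ Sel-id xs

  canonical-id : ∀ xs → canonical (Sel-id xs) ≈ id
  canonical-id [] = ≈.refl
  canonical-id (x ∷ xs) = ≈.trans identityʳ (≈.trans (≈.refl ⟩⊗⟨ canonical-id xs) ⊗-id)

  toSel : ∀ {xs ys} → xs ↭ ys → Sel xs ys
  toSel Perm.refl = Sel-id _
  toSel (Perm.prep x p) = here ∷ toSel p
  toSel (Perm.swap x y p) = there here ∷ (here ∷ toSel p)
  toSel (Perm.trans p q) = toSel p ⨾ toSel q

  rewire≈canonical : ∀ {xs ys} (p : xs ↭ ys) → rewire p ≈ canonical (toSel p)
  rewire≈canonical {xs} Perm.refl = ≈.sym (canonical-id xs)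
  rewire≈canonical (Perm.prep x p) = ≈.sym (≈.trans identityʳ (≈.refl ⟩⊗⟨ ≈.sym (rewire≈canonical p)))
  rewire≈canonical (Perm.swap x y p) = begin
    (id ⊗₁ (id ⊗₁ rewire p)) ∘ σ₁₂                                ≈⟨ (≈.refl ⟩⊗⟨ (≈.refl ⟩⊗⟨ rewire≈canonical p)) ⟩∘⟨refl ⟩
    (id ⊗₁ (id ⊗₁ canonical (toSel p))) ∘ σ₁₂                     ≈⟨ (≈.refl ⟩⊗⟨ ≈.sym identityʳ) ⟩∘⟨ ≈.sym σ₁₂∘id ⟩
    (id ⊗₁ ((id ⊗₁ canonical (toSel p)) ∘ id)) ∘ (σ₁₂ ∘ (id ⊗₁ id)) ∎
    where σ₁₂∘id = ≈.trans (refl⟩∘⟨ ⊗-id) identityʳ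
  rewire≈canonical (Perm.trans p q) =
    ≈.trans (rewire≈canonical q ⟩∘⟨ rewire≈canonical p) (≈.sym (canonical-⨾ (toSel p) (toSel q)))

  Pick⇒∈ : ∀ {y xs r} → Pick y xs r → y ∈ xs
  Pick⇒∈ here = Any.here refl
  Pick⇒∈ (there a) = Any.there (Pick⇒∈ a)

  Pick-⊆ : ∀ {y xs r v} → Pick y xs r → v ∈ r → v ∈ xs
  Pick-⊆ here m = Any.there m
  Pick-⊆ (there a) (Any.here e) = Any.here e
  Pick-⊆ (there a) (Any.there m) = Any.there (Pick-⊆ a m)

  Pick-irrelevant : ∀ {y xs r r'} → Unique xs → (a : Pick y xs r) (a' : Pick y xs r') →
                    _≡_ {A = Σ (List Var) (Pick y xs)} (r , a) (r' , a')
  Pick-irrelevant _ here here = refl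
  Pick-irrelevant (y≢ ∷ _) here (there a') = ⊥-elim (All.lookup y≢ (Pick⇒∈ a') refl)
  Pick-irrelevant (y≢ ∷ _) (there a) here = ⊥-elim (All.lookup y≢ (Pick⇒∈ a) refl)
  Pick-irrelevant (_ ∷ u) (there a) (there a') with Pick-irrelevant u a a'
  ... | refl = refl

  Unique-Pick : ∀ {y xs r} → Unique xs → Pick y xs r → Unique r
  Unique-Pick (_ ∷ u) here = u
  Unique-Pick (x≢ ∷ u) (there a) = All.tabulate (λ m → All.lookup x≢ (Pick-⊆ a m)) ∷ Unique-Pick u a

  canonical-irrelevant : ∀ {xs ys} → Unique xs → (s s' : Sel xs ys) → canonical s ≈ canonical s'
  canonical-irrelevant _ [] [] = ≈.refl
  canonical-irrelevant u (a ∷ s) (a' ∷ s') with Pick-irrelevant u a a'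
  ... | refl = (≈.refl ⟩⊗⟨ canonical-irrelevant (Unique-Pick u a) s s') ⟩∘⟨refl

  rewire-coherent : ∀ {xs ys} → Unique xs → (p q : xs ↭ ys) → rewire p ≈ rewire q
  rewire-coherent u p q = begin
    rewire p              ≈⟨ rewire≈canonical p ⟩
    canonical (toSel p)   ≈⟨ canonical-irrelevant u (toSel p) (toSel q) ⟩
    canonical (toSel q)   ≈⟨ rewire≈canonical q ⟨
    rewire q              ∎

module SortedSets {o ℓ e : Level} (𝒱 : VarStructure) (C : MarkovCategory o ℓ e)
                  (θ : VarStructure.Var 𝒱 → MarkovCategory.Ob C) where
  open Theory 𝒱 C θ
  open IsStrictTotalOrder isStrictTotalOrder using (compare; _≟_)
    renaming (trans to ≺-trans; irrefl to ≺-irrefl; asym to ≺-asym)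
  open DecMembership _≟_ using (_∈?_)

  ∈-∪⁻ : ∀ {v} xs ys → v ∈ xs ∪ ys → v ∈ xs ⊎ v ∈ ys
  ∈-∪⁻ [] ys m = inj₂ m
  ∈-∪⁻ (x ∷ xs) [] m = inj₁ m
  ∈-∪⁻ (x ∷ xs) (y ∷ ys) m with compare x y | m
  ... | tri< _ _ _ | here p = inj₁ (here p)
  ... | tri< _ _ _ | there m' = Sum.map₁ there (∈-∪⁻ xs (y ∷ ys) m')
  ... | tri≈ _ _ _ | here p = inj₁ (here p)
  ... | tri≈ _ _ _ | there m' = Sum.map there there (∈-∪⁻ xs ys m')
  ... | tri> _ _ _ | here p = inj₂ (here p)
  ... | tri> _ _ _ | there m' = Sum.map₂ there (∈-∪⁻ (x ∷ xs) ys m')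

  ∈-∪⁺ˡ : ∀ {v} xs ys → v ∈ xs → v ∈ xs ∪ ys
  ∈-∪⁺ˡ (x ∷ xs) [] m = m
  ∈-∪⁺ˡ (x ∷ xs) (y ∷ ys) m with compare x y | m
  ... | tri< _ _ _ | here p = here p
  ... | tri< _ _ _ | there m' = there (∈-∪⁺ˡ xs (y ∷ ys) m')
  ... | tri≈ _ _ _ | here p = here p
  ... | tri≈ _ _ _ | there m' = there (∈-∪⁺ˡ xs ys m')
  ... | tri> _ _ _ | m' = there (∈-∪⁺ˡ (x ∷ xs) ys m')

  ∈-∪⁺ʳ : ∀ {v} xs ys → v ∈ ys → v ∈ xs ∪ ys
  ∈-∪⁺ʳ [] ys m = m
  ∈-∪⁺ʳ (x ∷ xs) (y ∷ ys) m with compare x y | m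
  ... | tri< _ _ _ | m' = there (∈-∪⁺ʳ xs (y ∷ ys) m')
  ... | tri≈ _ refl _ | here refl = here refl
  ... | tri≈ _ _ _ | there m' = there (∈-∪⁺ʳ xs ys m')
  ... | tri> _ _ _ | here p = here p
  ... | tri> _ _ _ | there m' = there (∈-∪⁺ʳ (x ∷ xs) ys m')

  ∪-identityʳ : ∀ xs → xs ∪ [] ≡ xs
  ∪-identityʳ [] = refl
  ∪-identityʳ (x ∷ xs) = refl

  ∪-idem : ∀ xs → xs ∪ xs ≡ xs
  ∪-idem [] = refl
  ∪-idem (x ∷ xs) with compare x x
  ... | tri< x≺x _ _ = ⊥-elim (≺-irrefl refl x≺x)
  ... | tri≈ _ _ _ = cong (x ∷_) (∪-idem xs)
  ... | tri> _ _ x≺x = ⊥-elim (≺-irrefl refl x≺x)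

  Sorted⇒AllPairs : ∀ {xs} → Sorted xs → AllPairs _≺_ xs
  Sorted⇒AllPairs = Linked.Linked⇒AllPairs ≺-trans

  ∪-All : ∀ {P : Var → Set} xs ys → All P xs → All P ys → All P (xs ∪ ys)
  ∪-All xs ys pxs pys = All.tabulate λ m → Sum.[ All.lookup pxs , All.lookup pys ] (∈-∪⁻ xs ys m)

  ∪-AllPairs : ∀ xs ys → AllPairs _≺_ xs → AllPairs _≺_ ys → AllPairs _≺_ (xs ∪ ys)
  ∪-AllPairs [] _ _ sy = sy
  ∪-AllPairs (x ∷ xs) ys (x≺xs ∷ sx) = inner ys
    where
      inner : ∀ ys → AllPairs _≺_ ys → AllPairs _≺_ ((x ∷ xs) ∪ ys)
      inner [] _ = x≺xs ∷ sx
      inner (y ∷ ys) (y≺ys ∷ sy) with compare x y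
      ... | tri< x≺y _ _ =
        ∪-All xs (y ∷ ys) x≺xs (x≺y ∷ All.map (≺-trans x≺y) y≺ys) ∷ ∪-AllPairs xs (y ∷ ys) sx (y≺ys ∷ sy)
      ... | tri≈ _ refl _ = ∪-All xs ys x≺xs y≺ys ∷ ∪-AllPairs xs ys sx sy
      ... | tri> _ _ y≺x = ∪-All (x ∷ xs) ys (y≺x ∷ All.map (≺-trans y≺x) x≺xs) y≺ys ∷ inner ys sy

  ∪-sorted : ∀ {xs ys} → Sorted xs → Sorted ys → Sorted (xs ∪ ys)
  ∪-sorted sx sy = Linked.AllPairs⇒Linked (∪-AllPairs _ _ (Sorted⇒AllPairs sx) (Sorted⇒AllPairs sy))

  Sorted⇒Unique : ∀ {xs} → Sorted xs → Unique xs
  Sorted⇒Unique sx = AllPairs.map (λ x≺y x≡y → ≺-irrefl x≡y x≺y) (Sorted⇒AllPairs sx)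

  AllPairs-⊆-antisym : ∀ {xs ys} → AllPairs _≺_ xs → AllPairs _≺_ ys → xs ⊆ ys → ys ⊆ xs → xs ≡ ys
  AllPairs-⊆-antisym {[]} {[]} _ _ _ _ = refl
  AllPairs-⊆-antisym {[]} {y ∷ ys} _ _ _ ys⊆ with ys⊆ (here refl)
  ... | ()
  AllPairs-⊆-antisym {x ∷ xs} {[]} _ _ xs⊆ _ with xs⊆ (here refl)
  ... | ()
  AllPairs-⊆-antisym {x ∷ xs} {y ∷ ys} (x≺ ∷ sx) (y≺ ∷ sy) xs⊆ ys⊆ with xs⊆ (here refl) | ys⊆ (here refl)
  ... | there x∈ys | there y∈xs = ⊥-elim (≺-asym (All.lookup y≺ x∈ys) (All.lookup x≺ y∈xs))
  ... | there x∈ys | here refl = ⊥-elim (≺-irrefl refl (All.lookup y≺ x∈ys))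
  ... | here refl | _ = cong (x ∷_) (AllPairs-⊆-antisym sx sy (tail x≺ xs⊆) (tail y≺ ys⊆))
    where
      tail : ∀ {z zs zs'} → All (z ≺_) zs → (z ∷ zs) ⊆ (z ∷ zs') → zs ⊆ zs'
      tail z≺ ⊆′ m with ⊆′ (there m)
      ... | here refl = ⊥-elim (≺-irrefl refl (All.lookup z≺ m))
      ... | there m' = m'

  ⊆-antisym-sorted : ∀ {xs ys} → Sorted xs → Sorted ys → xs ⊆ ys → ys ⊆ xs → xs ≡ ys
  ⊆-antisym-sorted sx sy = AllPairs-⊆-antisym (Sorted⇒AllPairs sx) (Sorted⇒AllPairs sy)

  ⊆-antisym-↭ : ∀ {xs ys : List Var} → Unique xs → Unique ys → xs ⊆ ys → ys ⊆ xs → xs ↭ ys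
  ⊆-antisym-↭ ux uy xs⊆ ys⊆ = ∼bag⇒↭ (unique∧set⇒bag ux uy λ {v} → mk⇔ (xs⊆ {v}) (ys⊆ {v}))

  ∈-∩⁻ : ∀ {v} xs ys → v ∈ xs ∩ ys → v ∈ xs × v ∈ ys
  ∈-∩⁻ xs ys = ∈-filter⁻ (_∈? ys)

  ∈-∩⁺ : ∀ {v} xs ys → v ∈ xs → v ∈ ys → v ∈ xs ∩ ys
  ∈-∩⁺ xs ys = ∈-filter⁺ (_∈? ys)

  ∈-∖⁻ : ∀ {v} ys xs → v ∈ ys ∖ xs → v ∈ ys × v ∉ xs
  ∈-∖⁻ ys xs = ∈-filter⁻ (λ y → ¬? (y ∈? xs))

  ∈-∖⁺ : ∀ {v} ys xs → v ∈ ys → v ∉ xs → v ∈ ys ∖ xs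
  ∈-∖⁺ ys xs = ∈-filter⁺ (λ y → ¬? (y ∈? xs))

  ∖-sorted : ∀ {ys} xs → Sorted ys → Sorted (ys ∖ xs)
  ∖-sorted xs = Linked.filter⁺ (λ y → ¬? (y ∈? xs)) ≺-trans

  ∩-sorted : ∀ {xs} ys → Sorted xs → Sorted (xs ∩ ys)
  ∩-sorted ys = Linked.filter⁺ (_∈? ys) ≺-trans

  ∖-identityʳ : ∀ xs → xs ∖ [] ≡ xs
  ∖-identityʳ xs = filter-all (λ y → ¬? (y ∈? [])) (All.tabulate λ _ ())

  ∩-[] : ∀ xs → xs ∩ [] ≡ []
  ∩-[] xs = filter-none (_∈? []) {xs} (All.tabulate λ _ ())

  ⊆⇒∖≡[] : ∀ {ys} xs → ys ⊆ xs → ys ∖ xs ≡ []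
  ⊆⇒∖≡[] xs ys⊆ = filter-none (λ y → ¬? (y ∈? xs)) (All.tabulate λ m ∉ → ∉ (ys⊆ m))

  ++↭∪ : ∀ {xs ys} → Sorted xs → Sorted ys → Disjoint xs ys → (xs ++ ys) ↭ (xs ∪ ys)
  ++↭∪ {xs} {ys} sx sy xs#ys =
    ⊆-antisym-↭ (Unique.++⁺ (Sorted⇒Unique sx) (Sorted⇒Unique sy) xs#ys) (Sorted⇒Unique (∪-sorted sx sy))
      (λ m → Sum.[ ∈-∪⁺ˡ xs ys , ∈-∪⁺ʳ xs ys ] (∈-++⁻ xs m))
      (λ m → Sum.[ ∈-++⁺ˡ , ∈-++⁺ʳ xs ] (∈-∪⁻ xs ys m))

  ∖-≡ : ∀ {xs ys zs} → Sorted ys → Sorted zs → zs ⊆ ys → Disjoint xs zs → (∀ {v} → v ∈ ys → v ∈ xs ⊎ v ∈ zs) →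
        ys ∖ xs ≡ zs
  ∖-≡ {xs} {ys} {zs} sy sz zs⊆ys xs#zs ys⊆xs∪zs = ⊆-antisym-sorted (∖-sorted xs sy) sz sub sup
    where
      sub : ys ∖ xs ⊆ zs
      sub m with ∈-∖⁻ ys xs m
      ... | m' , m∉xs = Sum.[ (λ m∈xs → ⊥-elim (m∉xs m∈xs)) , (λ m∈zs → m∈zs) ] (ys⊆xs∪zs m')
      sup : zs ⊆ ys ∖ xs
      sup m = ∈-∖⁺ ys xs (zs⊆ys m) (λ m∈xs → xs#zs (m∈xs , m))

  ∪-∖ˡ : ∀ {xs ys} → Sorted xs → Sorted ys → Disjoint xs ys → (xs ∪ ys) ∖ xs ≡ ys
  ∪-∖ˡ {xs} {ys} sx sy xs#ys = ∖-≡ (∪-sorted sx sy) sy (∈-∪⁺ʳ xs ys) xs#ys (∈-∪⁻ xs ys)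

module Wiring {o ℓ e : Level} (𝒱 : VarStructure) (C : MarkovCategory o ℓ e)
              (θ : VarStructure.Var 𝒱 → MarkovCategory.Ob C) where
  open Theory 𝒱 C θ
  open MarkovReasoning C
  open Coherence 𝒱 C θ

  μ⁻¹∘μ : ∀ xs ys → μ⁻¹ xs ys ∘ μ xs ys ≈ id
  μ⁻¹∘μ [] ys = λ-iso₁
  μ⁻¹∘μ (x ∷ xs) ys = begin
    (α⇐ ∘ (id ⊗₁ μ⁻¹ xs ys)) ∘ ((id ⊗₁ μ xs ys) ∘ α⇒)   ≈⟨ assoc ⟩
    α⇐ ∘ ((id ⊗₁ μ⁻¹ xs ys) ∘ ((id ⊗₁ μ xs ys) ∘ α⇒))   ≈⟨ refl⟩∘⟨ pullˡ id⊗∘id⊗ ⟩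
    α⇐ ∘ ((id ⊗₁ (μ⁻¹ xs ys ∘ μ xs ys)) ∘ α⇒)   ≈⟨ refl⟩∘⟨ ((≈.trans (≈.refl ⟩⊗⟨ μ⁻¹∘μ xs ys) ⊗-id) ⟩∘⟨refl) ⟩
    α⇐ ∘ (id ∘ α⇒)   ≈⟨ refl⟩∘⟨ identityˡ ⟩
    α⇐ ∘ α⇒   ≈⟨ α-iso₁ ⟩
    id ∎

  μ⁻¹∘μ-cancel : ∀ xs ys {A B} {f : Hom (⟦ xs ⟧ ⊗₀ ⟦ ys ⟧) B} {g : Hom A (⟦ xs ⟧ ⊗₀ ⟦ ys ⟧)} →
            f ∘ μ⁻¹ xs ys ∘ μ xs ys ∘ g ≈ f ∘ g
  μ⁻¹∘μ-cancel xs ys = refl⟩∘⟨ cancelˡ (μ⁻¹∘μ xs ys)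

  ↭-++[] : ∀ (xs : List Var) → xs ↭ xs ++ []
  ↭-++[] [] = Perm.refl
  ↭-++[] (x ∷ xs) = Perm.prep x (↭-++[] xs)

  rewire-↭-++[] : ∀ (xs : List Var) → rewire (↭-++[] xs) ≈ μ xs [] ∘ ρ⇐
  rewire-↭-++[] [] = ≈.sym (≈.trans (refl⟩∘⟨ ρ⇐≈λ⇐) λ-iso₂)
  rewire-↭-++[] (x ∷ xs) = begin
    id ⊗₁ rewire (↭-++[] xs)   ≈⟨ ≈.refl ⟩⊗⟨ rewire-↭-++[] xs ⟩
    id ⊗₁ (μ xs [] ∘ ρ⇐)   ≈⟨ id⊗∘id⊗ ⟨
    (id ⊗₁ μ xs []) ∘ (id ⊗₁ ρ⇐)   ≈⟨ refl⟩∘⟨ α⇒∘ρ⇐ ⟨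
    (id ⊗₁ μ xs []) ∘ (α⇒ ∘ ρ⇐)   ≈⟨ sym-assoc ⟩
    ((id ⊗₁ μ xs []) ∘ α⇒) ∘ ρ⇐ ∎

  rewire-++⁺ˡ : ∀ W {xs ys} (p : xs ↭ ys) → rewire (++⁺ˡ W p) ≈ μ W ys ∘ (id ⊗₁ rewire p) ∘ μ⁻¹ W xs
  rewire-++⁺ˡ [] p = ≈.sym (≈.trans (refl⟩∘⟨ ≈.sym λ⇐-natural) (cancelˡ λ-iso₂))
  rewire-++⁺ˡ (w ∷ W) {xs} {ys} p = begin
    id ⊗₁ rewire (++⁺ˡ W p)   ≈⟨ ≈.refl ⟩⊗⟨ rewire-++⁺ˡ W p ⟩
    id ⊗₁ (μ W ys ∘ (id ⊗₁ rewire p) ∘ μ⁻¹ W xs)   ≈⟨ id⊗∘id⊗ ⟨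
    (id ⊗₁ μ W ys) ∘ (id ⊗₁ ((id ⊗₁ rewire p) ∘ μ⁻¹ W xs))   ≈⟨ refl⟩∘⟨ id⊗∘id⊗ ⟨
    (id ⊗₁ μ W ys) ∘ (id ⊗₁ (id ⊗₁ rewire p)) ∘ (id ⊗₁ μ⁻¹ W xs)   ≈⟨ refl⟩∘⟨ cancelˡ α-iso₂ ⟨
    (id ⊗₁ μ W ys) ∘ α⇒ ∘ α⇐ ∘ (id ⊗₁ (id ⊗₁ rewire p)) ∘ (id ⊗₁ μ⁻¹ W xs)   ≈⟨ refl⟩∘⟨ refl⟩∘⟨ slide α⇐-natural ⟩
    (id ⊗₁ μ W ys) ∘ α⇒ ∘ ((id ⊗₁ id) ⊗₁ rewire p) ∘ α⇐ ∘ (id ⊗₁ μ⁻¹ W xs)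
      ≈⟨ refl⟩∘⟨ refl⟩∘⟨ ((⊗-id ⟩⊗⟨ ≈.refl) ⟩∘⟨refl) ⟩
    (id ⊗₁ μ W ys) ∘ α⇒ ∘ (id ⊗₁ rewire p) ∘ α⇐ ∘ (id ⊗₁ μ⁻¹ W xs)   ≈⟨ sym-assoc ⟩
    μ (w ∷ W) ys ∘ (id ⊗₁ rewire p) ∘ μ⁻¹ (w ∷ W) xs ∎

  rewire-inverse : ∀ {xs ys} (p : xs ↭ ys) → rewire (↭-sym p) ∘ rewire p ≈ id
  rewire-inverse Perm.refl = identityˡ
  rewire-inverse (Perm.prep x p) = id⊗-inverse (rewire-inverse p)
  rewire-inverse (Perm.swap x y p) = begin
    ((id ⊗₁ (id ⊗₁ rewire (↭-sym p))) ∘ σ₁₂) ∘ ((id ⊗₁ (id ⊗₁ rewire p)) ∘ σ₁₂)   ≈⟨ assoc ⟩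
    (id ⊗₁ (id ⊗₁ rewire (↭-sym p))) ∘ (σ₁₂ ∘ ((id ⊗₁ (id ⊗₁ rewire p)) ∘ σ₁₂))   ≈⟨ refl⟩∘⟨ pullˡ σ₁₂-natural ⟩
    (id ⊗₁ (id ⊗₁ rewire (↭-sym p))) ∘ (((id ⊗₁ (id ⊗₁ rewire p)) ∘ σ₁₂) ∘ σ₁₂)   ≈⟨ refl⟩∘⟨ assoc ⟩
    (id ⊗₁ (id ⊗₁ rewire (↭-sym p))) ∘ ((id ⊗₁ (id ⊗₁ rewire p)) ∘ (σ₁₂ ∘ σ₁₂))   ≈⟨ refl⟩∘⟨ refl⟩∘⟨ σ₁₂-involutive ⟩
    (id ⊗₁ (id ⊗₁ rewire (↭-sym p))) ∘ ((id ⊗₁ (id ⊗₁ rewire p)) ∘ id)   ≈⟨ refl⟩∘⟨ identityʳ ⟩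
    (id ⊗₁ (id ⊗₁ rewire (↭-sym p))) ∘ (id ⊗₁ (id ⊗₁ rewire p))   ≈⟨ id⊗∘id⊗ ⟩
    id ⊗₁ ((id ⊗₁ rewire (↭-sym p)) ∘ (id ⊗₁ rewire p))   ≈⟨ ≈.refl ⟩⊗⟨ id⊗-inverse (rewire-inverse p) ⟩
    id ⊗₁ id   ≈⟨ ⊗-id ⟩
    id ∎
  rewire-inverse (Perm.trans p q) = begin
    (rewire (↭-sym p) ∘ rewire (↭-sym q)) ∘ (rewire q ∘ rewire p)   ≈⟨ assoc ⟩
    rewire (↭-sym p) ∘ (rewire (↭-sym q) ∘ (rewire q ∘ rewire p))   ≈⟨ refl⟩∘⟨ cancelˡ (rewire-inverse q) ⟩
    rewire (↭-sym p) ∘ rewire p   ≈⟨ rewire-inverse p ⟩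
    id ∎

  rewire-++⁺ˡ-inverse : ∀ W {xs ys} (p : xs ↭ ys) → rewire (++⁺ˡ W (↭-sym p)) ∘ rewire (++⁺ˡ W p) ≈ id
  rewire-++⁺ˡ-inverse [] p = rewire-inverse p
  rewire-++⁺ˡ-inverse (w ∷ W) p = id⊗-inverse (rewire-++⁺ˡ-inverse W p)

  proj∘rewire-↭-++[] : ∀ (W : List Var) → proj W [] ∘ rewire (↭-++[] W) ≈ id
  proj∘rewire-↭-++[] W = begin
    proj W [] ∘ rewire (↭-++[] W)   ≈⟨ refl⟩∘⟨ rewire-↭-++[] W ⟩
    (ρ⇒ ∘ (id ⊗₁ del) ∘ μ⁻¹ W []) ∘ (μ W [] ∘ ρ⇐)   ≈⟨ assoc ⟩
    ρ⇒ ∘ ((id ⊗₁ del) ∘ μ⁻¹ W []) ∘ (μ W [] ∘ ρ⇐)   ≈⟨ refl⟩∘⟨ assoc ⟩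
    ρ⇒ ∘ (id ⊗₁ del) ∘ μ⁻¹ W [] ∘ (μ W [] ∘ ρ⇐)   ≈⟨ refl⟩∘⟨ μ⁻¹∘μ-cancel W [] ⟩
    ρ⇒ ∘ (id ⊗₁ del) ∘ ρ⇐   ≈⟨ refl⟩∘⟨ (((≈.refl ⟩⊗⟨ del-I) ⟩∘⟨refl)) ⟩
    ρ⇒ ∘ (id ⊗₁ id) ∘ ρ⇐   ≈⟨ refl⟩∘⟨ (⊗-id ⟩∘⟨refl) ⟩
    ρ⇒ ∘ id ∘ ρ⇐   ≈⟨ refl⟩∘⟨ identityˡ ⟩
    ρ⇒ ∘ ρ⇐   ≈⟨ ρ-iso₂ ⟩
    id ∎

  proj∘rewire≈id : ∀ {D} → Unique D → (p : D ↭ D ++ []) → proj D [] ∘ rewire p ≈ id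
  proj∘rewire≈id {D} u p = ≈.trans (refl⟩∘⟨ rewire-coherent u p (↭-++[] D)) (proj∘rewire-↭-++[] D)

  graph : ∀ D L → Hom ⟦ D ⟧ ⟦ L ⟧ → Hom ⟦ D ⟧ ⟦ D ++ L ⟧
  graph D L f = μ D L ∘ ⟨ id , f ⟩

  graph-resp-≈ : ∀ D L {f f' : Hom ⟦ D ⟧ ⟦ L ⟧} → f ≈ f' → graph D L f ≈ graph D L f'
  graph-resp-≈ D L f≈f' = refl⟩∘⟨ ((≈.refl ⟩⊗⟨ f≈f') ⟩∘⟨refl)

  graph-rewire : ∀ D {L L'} (q : L ↭ L') (f : Hom ⟦ D ⟧ ⟦ L ⟧) →
                 graph D L' (rewire q ∘ f) ≈ rewire (++⁺ˡ D q) ∘ graph D L f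
  graph-rewire D {L} {L'} q f = begin
    μ D L' ∘ (id ⊗₁ (rewire q ∘ f)) ∘ copy                         ≈⟨ refl⟩∘⟨ (id⊗∘id⊗ ⟩∘⟨refl) ⟨
    μ D L' ∘ ((id ⊗₁ rewire q) ∘ (id ⊗₁ f)) ∘ copy                 ≈⟨ refl⟩∘⟨ assoc ⟩
    μ D L' ∘ (id ⊗₁ rewire q) ∘ (id ⊗₁ f) ∘ copy                   ≈⟨ refl⟩∘⟨ refl⟩∘⟨ cancelˡ (μ⁻¹∘μ D L) ⟨
    μ D L' ∘ (id ⊗₁ rewire q) ∘ μ⁻¹ D L ∘ μ D L ∘ (id ⊗₁ f) ∘ copy ≈⟨ refl⟩∘⟨ sym-assoc ⟩
    μ D L' ∘ ((id ⊗₁ rewire q) ∘ μ⁻¹ D L) ∘ graph D L f            ≈⟨ sym-assoc ⟩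
    (μ D L' ∘ (id ⊗₁ rewire q) ∘ μ⁻¹ D L) ∘ graph D L f            ≈⟨ rewire-++⁺ˡ D q ⟩∘⟨refl ⟨
    rewire (++⁺ˡ D q) ∘ graph D L f                                 ∎

  graph-relabel : ∀ W {A L R} (ρ : A ↭ L) (K : Hom ⟦ W ⟧ ⟦ A ⟧) (P : (W ++ A) ↭ R) →
                  rewire (Perm.trans (++⁺ˡ W (↭-sym ρ)) P) ∘ graph W L (rewire ρ ∘ K) ≈ rewire P ∘ graph W A K
  graph-relabel W {A} {L} ρ K P = begin
    (rewire P ∘ rewire (++⁺ˡ W (↭-sym ρ))) ∘ graph W L (rewire ρ ∘ K)        ≈⟨ refl⟩∘⟨ graph-rewire W ρ K ⟩
    (rewire P ∘ rewire (++⁺ˡ W (↭-sym ρ))) ∘ rewire (++⁺ˡ W ρ) ∘ graph W A K ≈⟨ assoc ⟩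
    rewire P ∘ rewire (++⁺ˡ W (↭-sym ρ)) ∘ rewire (++⁺ˡ W ρ) ∘ graph W A K
      ≈⟨ refl⟩∘⟨ cancelˡ (rewire-++⁺ˡ-inverse W ρ) ⟩
    rewire P ∘ graph W A K                                                   ∎

  graph-del : ∀ D (G : Hom ⟦ D ⟧ I) → graph D [] G ≈ rewire (↭-++[] D)
  graph-del D G = begin
    μ D [] ∘ ⟨ id , G ⟩  ≈⟨ refl⟩∘⟨ ⊗del∘copy ⟩
    μ D [] ∘ ρ⇐ ∘ id    ≈⟨ refl⟩∘⟨ identityʳ ⟩
    μ D [] ∘ ρ⇐         ≈⟨ rewire-↭-++[] D ⟨
    rewire (↭-++[] D)   ∎

  graph-[] : ∀ L (s : Hom I ⟦ L ⟧) → graph [] L s ≈ s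
  graph-[] L s = begin
    λ⇒ ∘ (id ⊗₁ s) ∘ copy  ≈⟨ refl⟩∘⟨ refl⟩∘⟨ copy-I ⟩
    λ⇒ ∘ (id ⊗₁ s) ∘ λ⇐    ≈⟨ refl⟩∘⟨ λ⇐-natural ⟨
    λ⇒ ∘ λ⇐ ∘ s            ≈⟨ cancelˡ λ-iso₂ ⟩
    s                      ∎

  fork : ∀ W X Y → Hom ⟦ W ⟧ ⟦ X ⟧ → Hom ⟦ W ⟧ ⟦ Y ⟧ → Hom ⟦ W ⟧ ⟦ W ++ (X ++ Y) ⟧
  fork W X Y gX gY = graph W (X ++ Y) (μ X Y ∘ ⟨ gX , gY ⟩)

  fork-resp-≈ : ∀ W X Y {gX gX' : Hom ⟦ W ⟧ ⟦ X ⟧} {gY gY' : Hom ⟦ W ⟧ ⟦ Y ⟧} → gX ≈ gX' → gY ≈ gY' →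
                fork W X Y gX gY ≈ fork W X Y gX' gY'
  fork-resp-≈ W X Y gX≈ gY≈ = graph-resp-≈ W (X ++ Y) (refl⟩∘⟨ ((gX≈ ⟩⊗⟨ gY≈) ⟩∘⟨refl))

  fork-del : ∀ D L {t : Hom ⟦ D ⟧ ⟦ D ⟧} (f : Hom ⟦ D ⟧ ⟦ L ⟧) (G : Hom ⟦ D ⟧ I) → t ≈ id →
             fork D L [] (f ∘ t) G ≈ graph D (L ++ []) (rewire (↭-++[] L) ∘ f)
  fork-del D L {t} f G t≈id = graph-resp-≈ D (L ++ []) (begin
    μ L [] ∘ ⟨ f ∘ t , G ⟩     ≈⟨ refl⟩∘⟨ ⊗del∘copy ⟩
    μ L [] ∘ ρ⇐ ∘ f ∘ t       ≈⟨ refl⟩∘⟨ refl⟩∘⟨ (refl⟩∘⟨ t≈id) ⟩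
    μ L [] ∘ ρ⇐ ∘ f ∘ id      ≈⟨ refl⟩∘⟨ refl⟩∘⟨ identityʳ ⟩
    μ L [] ∘ ρ⇐ ∘ f           ≈⟨ sym-assoc ⟩
    (μ L [] ∘ ρ⇐) ∘ f         ≈⟨ rewire-↭-++[] L ⟩∘⟨refl ⟨
    rewire (↭-++[] L) ∘ f     ∎)

  fork≈tensθ∘copy3θ : ∀ W X Y (gX : Hom ⟦ W ⟧ ⟦ X ⟧) (gY : Hom ⟦ W ⟧ ⟦ Y ⟧) →
                      tensθ W W (W ++ W) (X ++ Y) id (tensθ W X W Y gX gY) ∘ copy3θ W ≈ fork W X Y gX gY
  fork≈tensθ∘copy3θ W X Y gX gY = begin
    (μ W (X ++ Y) ∘ (id ⊗₁ (μ X Y ∘ (gX ⊗₁ gY) ∘ μ⁻¹ W W)) ∘ μ⁻¹ W (W ++ W))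
      ∘ ((μ W (W ++ W) ∘ (id ⊗₁ (μ W W ∘ copy)) ∘ μ⁻¹ W W) ∘ (μ W W ∘ copy))   ≈⟨ assoc ⟩
    μ W (X ++ Y) ∘ ((id ⊗₁ (μ X Y ∘ (gX ⊗₁ gY) ∘ μ⁻¹ W W)) ∘ μ⁻¹ W (W ++ W))
      ∘ ((μ W (W ++ W) ∘ (id ⊗₁ (μ W W ∘ copy)) ∘ μ⁻¹ W W) ∘ (μ W W ∘ copy))   ≈⟨ refl⟩∘⟨ assoc ⟩
    μ W (X ++ Y) ∘ (id ⊗₁ (μ X Y ∘ (gX ⊗₁ gY) ∘ μ⁻¹ W W)) ∘ μ⁻¹ W (W ++ W)
      ∘ ((μ W (W ++ W) ∘ (id ⊗₁ (μ W W ∘ copy)) ∘ μ⁻¹ W W) ∘ (μ W W ∘ copy))   ≈⟨ refl⟩∘⟨ refl⟩∘⟨ refl⟩∘⟨ assoc ⟩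
    μ W (X ++ Y) ∘ (id ⊗₁ (μ X Y ∘ (gX ⊗₁ gY) ∘ μ⁻¹ W W)) ∘ μ⁻¹ W (W ++ W)
      ∘ μ W (W ++ W) ∘ ((id ⊗₁ (μ W W ∘ copy)) ∘ μ⁻¹ W W) ∘ (μ W W ∘ copy)   ≈⟨ refl⟩∘⟨ μ⁻¹∘μ-cancel W (W ++ W) ⟩
    μ W (X ++ Y) ∘ (id ⊗₁ (μ X Y ∘ (gX ⊗₁ gY) ∘ μ⁻¹ W W))
      ∘ ((id ⊗₁ (μ W W ∘ copy)) ∘ μ⁻¹ W W) ∘ (μ W W ∘ copy)   ≈⟨ refl⟩∘⟨ refl⟩∘⟨ assoc ⟩
    μ W (X ++ Y) ∘ (id ⊗₁ (μ X Y ∘ (gX ⊗₁ gY) ∘ μ⁻¹ W W))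
      ∘ (id ⊗₁ (μ W W ∘ copy)) ∘ μ⁻¹ W W ∘ (μ W W ∘ copy)   ≈⟨ refl⟩∘⟨ refl⟩∘⟨ μ⁻¹∘μ-cancel W W ⟩
    μ W (X ++ Y) ∘ (id ⊗₁ (μ X Y ∘ (gX ⊗₁ gY) ∘ μ⁻¹ W W)) ∘ (id ⊗₁ (μ W W ∘ copy)) ∘ copy   ≈⟨ refl⟩∘⟨ pullˡ id⊗∘id⊗ ⟩
    μ W (X ++ Y) ∘ (id ⊗₁ ((μ X Y ∘ (gX ⊗₁ gY) ∘ μ⁻¹ W W) ∘ (μ W W ∘ copy))) ∘ copy
      ≈⟨ refl⟩∘⟨ ((≈.refl ⟩⊗⟨ ≈.trans assoc (refl⟩∘⟨ ≈.trans assoc (μ⁻¹∘μ-cancel W W))) ⟩∘⟨refl) ⟩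
    fork W X Y gX gY ∎

module Subkernels {o ℓ e : Level} (𝒱 : VarStructure) (C : MarkovCategory o ℓ e)
                  (θ : VarStructure.Var 𝒱 → MarkovCategory.Ob C) where
  open Theory 𝒱 C θ
  open MarkovReasoning C
  open Coherence 𝒱 C θ
  open SortedSets 𝒱 C θ
  open Wiring 𝒱 C θ

  -- KernelRep and ParMor with the lists they compute turned into parameters, so that equations between
  -- these lists can be eliminated by matching on refl. In ParMorOn, Z is the joint domain, Y' and V' the new
  -- outputs of a and b, ZX and ZU the parts of Z outside dom a and dom b, and Cd the joint codomain.
  KernelRepOn : (D E L : List Var) → Hom ⟦ D ⟧ ⟦ E ⟧ → Hom ⟦ D ⟧ ⟦ L ⟧ → Set e
  KernelRepOn D E L m f = Σ ((D ++ L) ↭ E) λ p → m ≈ rewire p ∘ graph D L f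

  ParMorOn : (a b : Raw) (Z Y' V' ZX ZU Cd : List Var) → Hom ⟦ Z ⟧ ⟦ Cd ⟧ → Set (ℓ ⊔ e)
  ParMorOn a b Z Y' V' ZX ZU Cd h =
    (dom a ∩ dom b ≡ cod a ∩ cod b) ×
    Σ (Hom ⟦ dom a ⟧ ⟦ Y' ⟧) λ f' → Σ (Hom ⟦ dom b ⟧ ⟦ V' ⟧) λ g' →
    KernelRepOn (dom a) (cod a) Y' (mor a) f' × KernelRepOn (dom b) (cod b) V' (mor b) g' ×
    Σ (Z ↭ (dom a ++ ZX)) λ p₁ → Σ (Z ↭ (dom b ++ ZU)) λ p₂ → Σ ((Z ++ (Y' ++ V')) ↭ Cd) λ p →
      h ≈ rewire p ∘ fork Z Y' V' (f' ∘ proj (dom a) ZX ∘ rewire p₁) (g' ∘ proj (dom b) ZU ∘ rewire p₂)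

  IsKernel-resp-≈ : ∀ {D E} {m m' : Hom ⟦ D ⟧ ⟦ E ⟧} → m ≈ m' → IsKernel (mk D E m) → IsKernel (mk D E m')
  IsKernel-resp-≈ m≈m' (f , p , m≈) = f , p , ≈.trans (≈.sym m≈m') m≈

  rewired-graph-isKernel : ∀ {D L E} (f : Hom ⟦ D ⟧ ⟦ L ⟧) (p : (D ++ L) ↭ E) → L ↭ (E ∖ D) →
                           IsKernel (mk D E (rewire p ∘ graph D L f))
  rewired-graph-isKernel {D} f p ρ = rewire ρ ∘ f , Perm.trans (++⁺ˡ D (↭-sym ρ)) p , ≈.sym (graph-relabel D ρ f p)

  state-isKernel : ∀ {E} (s : Hom I ⟦ E ⟧) → IsKernel (mk [] E s)
  state-isKernel {E} s =
    IsKernel-resp-≈ (≈.trans identityˡ (graph-[] E s))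
      (rewired-graph-isKernel s Perm.refl (↭-reflexive (sym (∖-identityʳ E))))

  rewire-isKernel : ∀ {E E'} (ψ : E ↭ E') → IsKernel (mk E E' (rewire ψ))
  rewire-isKernel {E} {E'} ψ = IsKernel-resp-≈ rewire≈ (rewired-graph-isKernel del p (↭-reflexive (sym E'∖E≡[])))
    where
      p = Perm.trans (↭-sym (↭-++[] E)) ψ
      E'∖E≡[] : E' ∖ E ≡ []
      E'∖E≡[] = ⊆⇒∖≡[] E (∈-resp-↭ (↭-sym ψ))
      rewire≈ : rewire p ∘ graph E [] del ≈ rewire ψ
      rewire≈ = begin
        (rewire ψ ∘ rewire (↭-sym (↭-++[] E))) ∘ graph E [] del        ≈⟨ refl⟩∘⟨ graph-del E del ⟩
        (rewire ψ ∘ rewire (↭-sym (↭-++[] E))) ∘ rewire (↭-++[] E)    ≈⟨ assoc ⟩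
        rewire ψ ∘ rewire (↭-sym (↭-++[] E)) ∘ rewire (↭-++[] E)      ≈⟨ refl⟩∘⟨ rewire-inverse (↭-++[] E) ⟩
        rewire ψ ∘ id                                                  ≈⟨ identityʳ ⟩
        rewire ψ                                                       ∎

  isKernel-dom⊆cod : ∀ {a : Raw} → IsKernel a → dom a ⊆ cod a
  isKernel-dom⊆cod (_ , p , _) m = ∈-resp-↭ p (∈-++⁺ˡ m)

  ⊑-dom : ∀ {f g : Raw} → f ⊑ g → dom f ⊆ dom g
  ⊑-dom {f} (Z , _ , _ , _ , _ , _ , ed , _) {v} m = subst (v ∈_) ed (∈-∪⁺ˡ (dom f) Z m)

  ⊑-cod : ∀ {f g : Raw} → f ⊑ g → cod f ⊆ cod g
  ⊑-cod {f} (Z , _ , _ , _ , h , q , _ , ec , _) {v} m =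
    subst (v ∈_) ec (isKernel-dom⊆cod (isKernel h) (subst (v ∈_) q (∈-∪⁺ˡ (cod f) Z m)))

  ⊑-dom∩cod⊆dom : ∀ {f g : Raw} → f ⊑ g → ∀ {v} → v ∈ dom g → v ∈ cod f → v ∈ dom f
  ⊑-dom∩cod⊆dom {f} (Z , _ , _ , (∩≡ , _) , _ , _ , ed , _) {v} m m' with ∈-∪⁻ (dom f) Z (subst (v ∈_) (sym ed) m)
  ... | inj₁ m'' = m''
  ... | inj₂ z = proj₁ (∈-∩⁻ (dom f) Z (subst (v ∈_) (sym ∩≡) (∈-∩⁺ (cod f) Z m' z)))

  private
    ⊑-rewire-on : ∀ {D E E'} (m : Hom ⟦ D ⟧ ⟦ E ⟧) (f : Hom ⟦ D ⟧ ⟦ E ∖ D ⟧) → KernelRepOn D E (E ∖ D) m f →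
                  Sorted E → Sorted E' → (ψ : E ↭ E') → ∀ D₀ E₀ ZX ZU → D₀ ≡ D → E₀ ≡ E → ZX ≡ [] → ZU ≡ D →
                  Σ (Hom ⟦ D₀ ⟧ ⟦ E₀ ⟧) λ k → ParMorOn (mk D E m) (idRaw []) D₀ (E ∖ D) [] ZX ZU E₀ k ×
                  Σ Kernel λ h → Σ (E₀ ≡ dom (raw h)) λ q → seqK (mk D₀ E₀ k) (raw h) q ≈K mk D E' (rewire ψ ∘ m)
    ⊑-rewire-on {D} {E} m f (pa , m≈) sE sE' ψ .D .E .[] .D refl refl refl refl =
      k , (trans (∩-[] D) (sym (∩-[] E)) , f , id , (pa , m≈) , id-rep , ↭-++[] D , Perm.refl , p , ≈.refl) ,
      record { raw = mk E _ (rewire ψ) ; dom-sorted = sE ; cod-sorted = sE' ; isKernel = rewire-isKernel ψ } ,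
      refl , refl , refl , (refl⟩∘⟨ k≈m)
      where
        p = Perm.trans (++⁺ˡ D (↭-sym (↭-++[] (E ∖ D)))) pa
        k = rewire p ∘ fork D (E ∖ D) [] (f ∘ proj D [] ∘ rewire (↭-++[] D))
                                         (id ∘ proj [] D ∘ rewire (Perm.refl {xs = D}))
        id-rep : KernelRepOn [] [] [] id id
        id-rep = Perm.refl , ≈.sym (≈.trans identityˡ (graph-[] [] id))
        k≈m : k ≈ m
        k≈m = begin
          k                                                                 ≈⟨ refl⟩∘⟨ fork-del D (E ∖ D) f _ (proj∘rewire-↭-++[] D) ⟩
          rewire p ∘ graph D (E ∖ D ++ []) (rewire (↭-++[] (E ∖ D)) ∘ f)  ≈⟨ graph-relabel D (↭-++[] (E ∖ D)) f pa ⟩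
          rewire pa ∘ graph D (E ∖ D) f                                    ≈⟨ m≈ ⟨
          m                                                                 ∎

  ⊑-rewire : ∀ {D E D' E'} {m : Hom ⟦ D ⟧ ⟦ E ⟧} {g : Hom ⟦ D' ⟧ ⟦ E' ⟧} → IsKernel (mk D E m) →
             Sorted E → Sorted E' → (e : D ≡ D') (ψ : E ↭ E') → g ≈ rewire ψ ∘ cast {D} {D'} {E} {E} e refl m →
             mk D E m ⊑ mk D' E' g
  ⊑-rewire {D} {E} {m = m} (f , rep) sE sE' refl ψ g≈ with
    ⊑-rewire-on m f rep sE sE' ψ (D ∪ []) (E ∪ []) ((D ∪ []) ∖ D) ((D ∪ []) ∖ [])
      (∪-identityʳ D) (∪-identityʳ E) (⊆⇒∖≡[] D (subst (_ ∈_) (∪-identityʳ D)))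
      (trans (∖-identityʳ (D ∪ [])) (∪-identityʳ D))
  ... | k , par , h , q , e₀ , e₁ , k≈ = [] , [] , k , par , h , q , e₀ , e₁ , ≈.trans k≈ (≈.sym g≈)

  ⊑-refl : (K : Kernel) → raw K ⊑ raw K
  ⊑-refl record { raw = mk D E m ; cod-sorted = sE ; isKernel = isK } =
    ⊑-rewire isK sE sE refl (Perm.refl {xs = E}) (≈.sym identityˡ)

  ▷-intro : ∀ {T} (K : Kernel) → T ⊆ cod (raw K) → (dom (raw K) ▷ T) (raw K)
  ▷-intro K T⊆ = K , ⊑-refl K , refl , T⊆

  ▷-dom : ∀ {S T} {a : Raw} → (S ▷ T) a → S ⊆ dom a
  ▷-dom (record { raw = mk _ _ _ } , f⊑a , refl , _) = ⊑-dom f⊑a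

  ▷-cod : ∀ {S T} {a : Raw} → (S ▷ T) a → T ⊆ cod a
  ▷-cod (_ , f⊑a , _ , T⊆) m = ⊑-cod f⊑a (T⊆ m)

  ▷-dom∩T⊆S : ∀ {S T} {a : Raw} → (S ▷ T) a → ∀ {v} → v ∈ dom a → v ∈ T → v ∈ S
  ▷-dom∩T⊆S (record { raw = mk _ _ _ } , f⊑a , refl , T⊆) m m' = ⊑-dom∩cod⊆dom f⊑a m (T⊆ m')

  private
    ⊑⇒rewire-on : ∀ {D E Z E'} (m : Hom ⟦ D ⟧ ⟦ E ⟧) (Z' V' ZX ZU LR Dh : List Var) → Unique D →
                  (e : D ≡ Z') → V' ≡ [] → ZX ≡ [] → LR ≡ [] →
                  (k : Hom ⟦ Z' ⟧ ⟦ Dh ⟧) → ParMorOn (mk D E m) (idRaw Z) Z' (E ∖ D) V' ZX ZU Dh k →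
                  (mh : Hom ⟦ Dh ⟧ ⟦ E' ⟧) (fh : Hom ⟦ Dh ⟧ ⟦ LR ⟧) → KernelRepOn Dh E' LR mh fh →
                  Σ (E ↭ E') λ ψ → mh ∘ k ≈ rewire ψ ∘ cast {D} {Z'} {E} {E} e refl m
    ⊑⇒rewire-on {D} {E} {Z} m .D .[] .[] ZU .[] Dh uD refl refl refl refl k
      (_ , f' , g' , (pa , m≈) , _ , p₁ , p₂ , p , k≈) mh fh (ph , mh≈) = ψ , mh∘k≈
      where
        L = E ∖ D
        ψ = Perm.trans (↭-sym pa) (Perm.trans (++⁺ˡ D (↭-++[] L)) (Perm.trans p (Perm.trans (↭-++[] Dh) ph)))
        graph≈ : graph D L f' ≈ rewire (↭-sym pa) ∘ m
        graph≈ = ≈.sym (≈.trans (refl⟩∘⟨ m≈) (cancelˡ (rewire-inverse pa)))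
        mh∘k≈ : mh ∘ k ≈ rewire ψ ∘ m
        mh∘k≈ = begin
          mh ∘ k
            ≈⟨ mh≈ ⟩∘⟨ k≈ ⟩
          (rewire ph ∘ graph Dh [] fh) ∘ rewire p
            ∘ fork D L [] (f' ∘ proj D [] ∘ rewire p₁) (g' ∘ proj Z ZU ∘ rewire p₂)
            ≈⟨ (refl⟩∘⟨ graph-del Dh fh) ⟩∘⟨ (refl⟩∘⟨ fork-del D L f' _ (proj∘rewire≈id uD p₁)) ⟩
          (rewire ph ∘ rewire (↭-++[] Dh)) ∘ rewire p ∘ graph D (L ++ []) (rewire (↭-++[] L) ∘ f')
            ≈⟨ refl⟩∘⟨ refl⟩∘⟨ graph-rewire D (↭-++[] L) f' ⟩
          (rewire ph ∘ rewire (↭-++[] Dh)) ∘ rewire p ∘ rewire (++⁺ˡ D (↭-++[] L)) ∘ graph D L f'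
            ≈⟨ refl⟩∘⟨ refl⟩∘⟨ refl⟩∘⟨ graph≈ ⟩
          (rewire ph ∘ rewire (↭-++[] Dh)) ∘ rewire p ∘ rewire (++⁺ˡ D (↭-++[] L)) ∘ rewire (↭-sym pa) ∘ m
            ≈⟨ ≈.trans sym-assoc (≈.trans sym-assoc sym-assoc) ⟩
          rewire ψ ∘ m
            ∎

  ⊑⇒rewire : ∀ {D E D' E'} {m : Hom ⟦ D ⟧ ⟦ E ⟧} {g : Hom ⟦ D' ⟧ ⟦ E' ⟧} → Sorted D →
             mk D E m ⊑ mk D' E' g → D' ⊆ D → E' ⊆ E →
             Σ (D ≡ D') λ e → Σ (E ↭ E') λ ψ → g ≈ rewire ψ ∘ cast {D} {D'} {E} {E} e refl m
  ⊑⇒rewire {D} {E} {E' = E'} {m} sD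
    (Z , sZ , k , par , record { raw = mk _ _ mh ; isKernel = fh , rep } , refl , refl , refl , g≈) D'⊆D E'⊆E =
    D≡D∪Z , proj₁ mh∘k≈ , ≈.trans (≈.sym g≈) (proj₂ mh∘k≈)
    where
      D≡D∪Z : D ≡ D ∪ Z
      D≡D∪Z = ⊆-antisym-sorted sD (∪-sorted sD sZ) (∈-∪⁺ˡ D Z) D'⊆D
      mh∘k≈ = ⊑⇒rewire-on m (D ∪ Z) (Z ∖ Z) ((D ∪ Z) ∖ D) ((D ∪ Z) ∖ Z) (E' ∖ (E ∪ Z)) (E ∪ Z)
                (Sorted⇒Unique sD) D≡D∪Z (⊆⇒∖≡[] Z (λ z → z)) (⊆⇒∖≡[] D D'⊆D)
                (⊆⇒∖≡[] (E ∪ Z) (λ z → ∈-∪⁺ˡ E Z (E'⊆E z))) k par mh fh rep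

  private
    ParMorOn⇒fork : ∀ {W E₁ E₂ Y' V' Cd} {m₁ : Hom ⟦ W ⟧ ⟦ E₁ ⟧} {m₂ : Hom ⟦ W ⟧ ⟦ E₂ ⟧} Z ZX ZU →
                    (e : Z ≡ W) → ZX ≡ [] → ZU ≡ [] → {h : Hom ⟦ Z ⟧ ⟦ Cd ⟧} →
                    ParMorOn (mk W E₁ m₁) (mk W E₂ m₂) Z Y' V' ZX ZU Cd h →
                    Σ (Hom ⟦ W ⟧ ⟦ Y' ⟧) λ gX → Σ (Hom ⟦ W ⟧ ⟦ V' ⟧) λ gY → Σ ((W ++ (Y' ++ V')) ↭ Cd) λ p →
                      cast {Z} {W} {Cd} {Cd} e refl h ≈ rewire p ∘ fork W Y' V' gX gY
    ParMorOn⇒fork _ _ _ refl refl refl (_ , _ , _ , _ , _ , _ , _ , p , h≈) = _ , _ , p , h≈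

  ParMor⇒fork : ∀ {W E₁ E₂} {m₁ : Hom ⟦ W ⟧ ⟦ E₁ ⟧} {m₂ : Hom ⟦ W ⟧ ⟦ E₂ ⟧} {h : Hom ⟦ W ∪ W ⟧ ⟦ E₁ ∪ E₂ ⟧} →
                ParMor (mk W E₁ m₁) (mk W E₂ m₂) h → (e : W ∪ W ≡ W) →
                Σ (Hom ⟦ W ⟧ ⟦ E₁ ∖ W ⟧) λ gX → Σ (Hom ⟦ W ⟧ ⟦ E₂ ∖ W ⟧) λ gY →
                Σ ((W ++ ((E₁ ∖ W) ++ (E₂ ∖ W))) ↭ (E₁ ∪ E₂)) λ p →
                  cast {W ∪ W} {W} {E₁ ∪ E₂} {E₁ ∪ E₂} e refl h ≈ rewire p ∘ fork W (E₁ ∖ W) (E₂ ∖ W) gX gY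
  ParMor⇒fork {W} par e = ParMorOn⇒fork (W ∪ W) _ _ e WW∖W≡[] WW∖W≡[] par
    where
      WW∖W≡[] : (W ∪ W) ∖ W ≡ []
      WW∖W≡[] = ⊆⇒∖≡[] W (λ {v} m → subst (v ∈_) e m)

  private
    fork⇒ParMorOn : ∀ {W X Y E₁ E₂ Cd} (ρ₁ : (W ++ X) ↭ E₁) (ρ₂ : (W ++ Y) ↭ E₂)
                      (gX : Hom ⟦ W ⟧ ⟦ X ⟧) (gY : Hom ⟦ W ⟧ ⟦ Y ⟧) → W ∩ W ≡ E₁ ∩ E₂ →
                      (pc : (W ++ (X ++ Y)) ↭ Cd) → ∀ Z Y' V' ZX ZU (e : Z ≡ W) →
                      Y' ≡ X → V' ≡ Y → ZX ≡ [] → ZU ≡ [] → (X ++ Y) ↭ (Cd ∖ Z) →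
                      Σ (Hom ⟦ Z ⟧ ⟦ Cd ⟧) λ h →
                        ParMorOn (mk W E₁ (rewire ρ₁ ∘ graph W X gX)) (mk W E₂ (rewire ρ₂ ∘ graph W Y gY))
                                 Z Y' V' ZX ZU Cd h ×
                        IsKernel (mk Z Cd h) × cast {Z} {W} {Cd} {Cd} e refl h ≈ rewire pc ∘ fork W X Y gX gY
    fork⇒ParMorOn {W} {X} {Y} ρ₁ ρ₂ gX gY ∩≡ pc _ _ _ _ _ refl refl refl refl refl τ =
      h , (∩≡ , gX , gY , (ρ₁ , ≈.refl) , (ρ₂ , ≈.refl) , ↭-++[] W , ↭-++[] W , pc , ≈.refl) ,
      rewired-graph-isKernel _ pc τ , refl⟩∘⟨ fork-resp-≈ W X Y (restrict {X} gX) (restrict {Y} gY)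
      where
        restrict : ∀ {L} (g : Hom ⟦ W ⟧ ⟦ L ⟧) → g ∘ proj W [] ∘ rewire (↭-++[] W) ≈ g
        restrict g = ≈.trans (refl⟩∘⟨ proj∘rewire-↭-++[] W) identityʳ
        h = rewire pc ∘ fork W X Y (gX ∘ proj W [] ∘ rewire (↭-++[] W)) (gY ∘ proj W [] ∘ rewire (↭-++[] W))

  fork⇒ParMor : ∀ {W X Y E₁ E₂} (ρ₁ : (W ++ X) ↭ E₁) (ρ₂ : (W ++ Y) ↭ E₂)
                  (gX : Hom ⟦ W ⟧ ⟦ X ⟧) (gY : Hom ⟦ W ⟧ ⟦ Y ⟧) →
                E₁ ∖ W ≡ X → E₂ ∖ W ≡ Y → W ∩ W ≡ E₁ ∩ E₂ → (e : W ∪ W ≡ W) →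
                (pc : (W ++ (X ++ Y)) ↭ (E₁ ∪ E₂)) → (X ++ Y) ↭ ((E₁ ∪ E₂) ∖ (W ∪ W)) →
                Σ (Hom ⟦ W ∪ W ⟧ ⟦ E₁ ∪ E₂ ⟧) λ h →
                  ParMor (mk W E₁ (rewire ρ₁ ∘ graph W X gX)) (mk W E₂ (rewire ρ₂ ∘ graph W Y gY)) h ×
                  IsKernel (mk (W ∪ W) (E₁ ∪ E₂) h) ×
                  cast {W ∪ W} {W} {E₁ ∪ E₂} {E₁ ∪ E₂} e refl h ≈ rewire pc ∘ fork W X Y gX gY
  fork⇒ParMor {W} ρ₁ ρ₂ gX gY E₁∖W≡X E₂∖W≡Y ∩≡ e pc τ =
    fork⇒ParMorOn ρ₁ ρ₂ gX gY ∩≡ pc (W ∪ W) _ _ _ _ e E₁∖W≡X E₂∖W≡Y WW∖W≡[] WW∖W≡[] τ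
    where
      WW∖W≡[] : (W ∪ W) ∖ W ≡ []
      WW∖W≡[] = ⊆⇒∖≡[] W (λ {v} m → subst (v ∈_) e m)

module Proposition8 {o ℓ e : Level} (𝒱 : VarStructure) (C : MarkovCategory o ℓ e)
                    (θ : VarStructure.Var 𝒱 → MarkovCategory.Ob C) where
  open Theory 𝒱 C θ
  open MarkovReasoning C
  open SortedSets 𝒱 C θ
  open Wiring 𝒱 C θ
  open Subkernels 𝒱 C θ

  DisplaysCI-resp-≈ : ∀ {W X Y} {s s' : Hom I ⟦ (W ∪ X) ∪ Y ⟧} → s ≈ s' → DisplaysCI W X Y s → DisplaysCI W X Y s'
  DisplaysCI-resp-≈ s≈s' (sW , gX , gY , P , s≈) = sW , gX , gY , P , ≈.trans (≈.sym s≈s') s≈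

  fork⇒DisplaysCI : ∀ {W X Y X' Y'} {s : Hom I ⟦ (W ∪ X) ∪ Y ⟧} → X' ≡ X → Y' ≡ Y →
                    (sW : Hom I ⟦ W ⟧) (gX : Hom ⟦ W ⟧ ⟦ X' ⟧) (gY : Hom ⟦ W ⟧ ⟦ Y' ⟧)
                    (P : (W ++ (X' ++ Y')) ↭ ((W ∪ X) ∪ Y)) → s ≈ (rewire P ∘ fork W X' Y' gX gY) ∘ sW →
                    DisplaysCI W X Y s
  fork⇒DisplaysCI {W} {X} {Y} {s = s} refl refl sW gX gY P s≈ = sW , gX , gY , P , (begin
    s                                                           ≈⟨ s≈ ⟩
    (rewire P ∘ fork W X Y gX gY) ∘ sW                         ≈⟨ (refl⟩∘⟨ fork≈tensθ∘copy3θ W X Y gX gY) ⟩∘⟨refl ⟨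
    (rewire P ∘ tensθ W W (W ++ W) (X ++ Y) id (tensθ W X W Y gX gY) ∘ copy3θ W) ∘ sW
                                                                ≈⟨ ≈.trans assoc (refl⟩∘⟨ assoc) ⟩
    rewire P ∘ tensθ W W (W ++ W) (X ++ Y) id (tensθ W X W Y gX gY) ∘ copy3θ W ∘ sW ∎)

  DisplaysCI⇒fork : ∀ {W X Y} {s : Hom I ⟦ (W ∪ X) ∪ Y ⟧} → DisplaysCI W X Y s →
                    Σ (Hom I ⟦ W ⟧) λ sW → Σ (Hom ⟦ W ⟧ ⟦ X ⟧) λ gX → Σ (Hom ⟦ W ⟧ ⟦ Y ⟧) λ gY →
                    Σ ((W ++ (X ++ Y)) ↭ ((W ∪ X) ∪ Y)) λ P → s ≈ (rewire P ∘ fork W X Y gX gY) ∘ sW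
  DisplaysCI⇒fork {W} {X} {Y} {s} (sW , gX , gY , P , s≈) = sW , gX , gY , P , (begin
    s                                                                                ≈⟨ s≈ ⟩
    rewire P ∘ tensθ W W (W ++ W) (X ++ Y) id (tensθ W X W Y gX gY) ∘ copy3θ W ∘ sW
                                                                ≈⟨ refl⟩∘⟨ pullˡ (fork≈tensθ∘copy3θ W X Y gX gY) ⟩
    rewire P ∘ fork W X Y gX gY ∘ sW                                                ≈⟨ sym-assoc ⟩
    (rewire P ∘ fork W X Y gX gY) ∘ sW                                              ∎)

  module Setting (W X Y : List Var) (sW : Sorted W) (sX : Sorted X) (sY : Sorted Y)
           (W#X : Disjoint W X) (W#Y : Disjoint W Y) (X#Y : Disjoint X Y) where

    R : List Var
    R = (W ∪ X) ∪ Y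

    In₃ : Var → Set
    In₃ v = v ∈ W ⊎ v ∈ X ⊎ v ∈ Y

    R⇒In₃ : ∀ {v} → v ∈ R → In₃ v
    R⇒In₃ m with ∈-∪⁻ (W ∪ X) Y m
    ... | inj₁ m' = Sum.map₂ inj₁ (∈-∪⁻ W X m')
    ... | inj₂ m' = inj₂ (inj₂ m')

    In₃⇒R : ∀ {v} → In₃ v → v ∈ R
    In₃⇒R (inj₁ m) = ∈-∪⁺ˡ (W ∪ X) Y (∈-∪⁺ˡ W X m)
    In₃⇒R (inj₂ (inj₁ m)) = ∈-∪⁺ˡ (W ∪ X) Y (∈-∪⁺ʳ W X m)
    In₃⇒R (inj₂ (inj₂ m)) = ∈-∪⁺ʳ (W ∪ X) Y m

    sR : Sorted R
    sR = ∪-sorted (∪-sorted sW sX) sY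

    -- The codomain of the parallel composition of W → W ∪ X and W → W ∪ Y.
    Cd : List Var
    Cd = (W ∪ X) ∪ (W ∪ Y)

    sCd : Sorted Cd
    sCd = ∪-sorted (∪-sorted sW sX) (∪-sorted sW sY)

    Cd≡R : Cd ≡ R
    Cd≡R = ⊆-antisym-sorted sCd sR (λ m → In₃⇒R (Cd⇒In₃ m)) (λ m → In₃⇒Cd (R⇒In₃ m))
      where
        Cd⇒In₃ : ∀ {v} → v ∈ Cd → In₃ v
        Cd⇒In₃ m with ∈-∪⁻ (W ∪ X) (W ∪ Y) m
        ... | inj₁ m' = Sum.map₂ inj₁ (∈-∪⁻ W X m')
        ... | inj₂ m' = Sum.map₂ inj₂ (∈-∪⁻ W Y m')
        In₃⇒Cd : ∀ {v} → In₃ v → v ∈ Cd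
        In₃⇒Cd (inj₁ m) = ∈-∪⁺ˡ (W ∪ X) (W ∪ Y) (∈-∪⁺ˡ W X m)
        In₃⇒Cd (inj₂ (inj₁ m)) = ∈-∪⁺ˡ (W ∪ X) (W ∪ Y) (∈-∪⁺ʳ W X m)
        In₃⇒Cd (inj₂ (inj₂ m)) = ∈-∪⁺ʳ (W ∪ X) (W ∪ Y) (∈-∪⁺ʳ W Y m)

    W#X∪Y : Disjoint W (X ∪ Y)
    W#X∪Y (w , m) = Sum.[ (λ x → W#X (w , x)) , (λ y → W#Y (w , y)) ] (∈-∪⁻ X Y m)

    R∖W≡X∪Y : R ∖ W ≡ X ∪ Y
    R∖W≡X∪Y = ∖-≡ sR (∪-sorted sX sY) (λ m → In₃⇒R (inj₂ (∈-∪⁻ X Y m))) W#X∪Y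
                (λ m → Sum.map₂ Sum.[ ∈-∪⁺ˡ X Y , ∈-∪⁺ʳ X Y ] (R⇒In₃ m))

    X++Y↭R∖W : (X ++ Y) ↭ (R ∖ W)
    X++Y↭R∖W = Perm.trans (++↭∪ sX sY X#Y) (↭-reflexive (sym R∖W≡X∪Y))

    W∩W≡[W∪X]∩[W∪Y] : W ∩ W ≡ (W ∪ X) ∩ (W ∪ Y)
    W∩W≡[W∪X]∩[W∪Y] = ⊆-antisym-sorted (∩-sorted W sW) (∩-sorted (W ∪ Y) (∪-sorted sW sX)) sub sup
      where
        sub : W ∩ W ⊆ (W ∪ X) ∩ (W ∪ Y)
        sub m = let w = proj₁ (∈-∩⁻ W W m) in ∈-∩⁺ (W ∪ X) (W ∪ Y) (∈-∪⁺ˡ W X w) (∈-∪⁺ˡ W Y w)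
        sup : (W ∪ X) ∩ (W ∪ Y) ⊆ W ∩ W
        sup m with ∈-∩⁻ (W ∪ X) (W ∪ Y) m
        ... | m₁ , m₂ with ∈-∪⁻ W X m₁ | ∈-∪⁻ W Y m₂
        ...   | inj₁ w | _ = ∈-∩⁺ W W w w
        ...   | inj₂ _ | inj₁ w = ∈-∩⁺ W W w w
        ...   | inj₂ x | inj₂ y = ⊥-elim (X#Y (x , y))

    graph-kernel : ∀ {Z} → Sorted Z → Disjoint W Z → Hom ⟦ W ⟧ ⟦ Z ⟧ → Kernel
    graph-kernel sZ W#Z g = record
      { raw = mk W (W ∪ _) (rewire (++↭∪ sW sZ W#Z) ∘ graph W _ g)
      ; dom-sorted = sW
      ; cod-sorted = ∪-sorted sW sZ
      ; isKernel = rewired-graph-isKernel g (++↭∪ sW sZ W#Z) (↭-reflexive (sym (∪-∖ˡ sW sZ W#Z)))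
      }

    forward : (s : Hom ⟦ [] ⟧ ⟦ R ⟧) → DisplaysCI W X Y s → DIBI-CI W X Y (mk [] R s)
    forward s ci with DisplaysCI⇒fork {W} {X} {Y} ci
    ... | s_W , gX , gY , P , s≈ =
      b₁ , b₂ , refl , (refl , refl , ≈.sym s≈) , ▷-intro b₁ (λ m → m) ,
      c₁ , c₂ , h , par , h⊑b₂ , ▷-intro c₁ (∈-∪⁺ʳ W X) , ▷-intro c₂ (∈-∪⁺ʳ W Y)
      where
        m₂ = rewire P ∘ fork W X Y gX gY
        b₁ b₂ c₁ c₂ : Kernel
        b₁ = record { raw = mk [] W s_W ; dom-sorted = [] ; cod-sorted = sW ; isKernel = state-isKernel s_W }
        b₂ = record { raw = mk W R m₂ ; dom-sorted = sW ; cod-sorted = sR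
                    ; isKernel = rewired-graph-isKernel _ P X++Y↭R∖W }
        c₁ = graph-kernel sX W#X gX
        c₂ = graph-kernel sY W#Y gY
        R↭Cd : R ↭ Cd
        R↭Cd = ↭-reflexive (sym Cd≡R)
        parallel = fork⇒ParMor (++↭∪ sW sX W#X) (++↭∪ sW sY W#Y) gX gY (∪-∖ˡ sW sX W#X) (∪-∖ˡ sW sY W#Y)
                     W∩W≡[W∪X]∩[W∪Y] (∪-idem W) (Perm.trans P R↭Cd)
                     (Perm.trans X++Y↭R∖W (↭-reflexive (cong₂ _∖_ (sym Cd≡R) (sym (∪-idem W)))))
        h = proj₁ parallel
        par = proj₁ (proj₂ parallel)
        h-isKernel = proj₁ (proj₂ (proj₂ parallel))
        h≈fork = proj₂ (proj₂ (proj₂ parallel))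
        m₂≈ : m₂ ≈ rewire (↭-sym R↭Cd) ∘ cast {W ∪ W} {W} {Cd} {Cd} (∪-idem W) refl h
        m₂≈ = begin
          m₂                                                        ≈⟨ cancelˡ (rewire-inverse R↭Cd) ⟨
          rewire (↭-sym R↭Cd) ∘ rewire R↭Cd ∘ m₂                    ≈⟨ refl⟩∘⟨ sym-assoc ⟩
          rewire (↭-sym R↭Cd) ∘ rewire (Perm.trans P R↭Cd) ∘ fork W X Y gX gY ≈⟨ refl⟩∘⟨ h≈fork ⟨
          rewire (↭-sym R↭Cd) ∘ cast {W ∪ W} {W} {Cd} {Cd} (∪-idem W) refl h ∎
        h⊑b₂ = ⊑-rewire h-isKernel sCd sR (∪-idem W) (↭-sym R↭Cd) m₂≈

    fork-decomposition : ∀ {E₁ A₁ A₂ B₁ B₂} → E₁ ≡ W → A₁ ≡ W → A₂ ≡ W → B₁ ∖ W ≡ X → B₂ ∖ W ≡ Y →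
                         (m₁ : Hom I ⟦ E₁ ⟧) (m₂ : Hom ⟦ E₁ ⟧ ⟦ R ⟧)
                         {mc₁ : Hom ⟦ A₁ ⟧ ⟦ B₁ ⟧} {mc₂ : Hom ⟦ A₂ ⟧ ⟦ B₂ ⟧} {h : Hom ⟦ A₁ ∪ A₂ ⟧ ⟦ B₁ ∪ B₂ ⟧} →
                         ParMor (mk A₁ B₁ mc₁) (mk A₂ B₂ mc₂) h → (e : A₁ ∪ A₂ ≡ E₁) (ψ : (B₁ ∪ B₂) ↭ R) →
                         m₂ ≈ rewire ψ ∘ cast {A₁ ∪ A₂} {E₁} {B₁ ∪ B₂} {B₁ ∪ B₂} e refl h →
                         DisplaysCI W X Y (m₂ ∘ m₁)
    fork-decomposition refl refl refl B₁∖W≡X B₂∖W≡Y m₁ m₂ par e ψ m₂≈ with ParMor⇒fork par e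
    ... | gX , gY , p , h≈ =
      fork⇒DisplaysCI {W} {X} {Y} B₁∖W≡X B₂∖W≡Y m₁ gX gY (Perm.trans p ψ)
        (≈.trans m₂≈ (≈.trans (refl⟩∘⟨ h≈) sym-assoc) ⟩∘⟨refl)

    backward : (s : Hom ⟦ [] ⟧ ⟦ R ⟧) → DIBI-CI W X Y (mk [] R s) → DisplaysCI W X Y s
    backward s
      ( record { raw = mk _ E₁ m₁ ; cod-sorted = sE₁ }
      , record { raw = mk _ _ m₂ ; isKernel = isK₂ }
      , refl , (refl , refl , s≈) , ∅▷W
      , ( record { raw = mk A₁ B₁ mc₁ ; dom-sorted = sA₁ ; cod-sorted = sB₁ ; isKernel = isKc₁ }
        , record { raw = mk A₂ B₂ mc₂ ; dom-sorted = sA₂ ; cod-sorted = sB₂ ; isKernel = isKc₂ }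
        , h , par , h⊑b₂ , W▷X , W▷Y))
      = DisplaysCI-resp-≈ {W} {X} {Y} s≈
          (fork-decomposition E₁≡W A₁≡W A₂≡W B₁∖W≡X B₂∖W≡Y m₁ m₂ par A₁∪A₂≡E₁ ψ m₂≈)
      where
        B₁∩B₂⊆A₁∩A₂ : ∀ {v} → v ∈ B₁ → v ∈ B₂ → v ∈ A₁ × v ∈ A₂
        B₁∩B₂⊆A₁∩A₂ m m' = ∈-∩⁻ A₁ A₂ (subst (_ ∈_) (sym (proj₁ par)) (∈-∩⁺ B₁ B₂ m m'))
        X∉A₁ : ∀ {v} → v ∈ X → v ∈ A₁ → ⊥
        X∉A₁ x a = W#X (▷-dom∩T⊆S W▷X a x , x)
        Y∉A₂ : ∀ {v} → v ∈ Y → v ∈ A₂ → ⊥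
        Y∉A₂ y a = W#Y (▷-dom∩T⊆S W▷Y a y , y)
        X∉A₂ : ∀ {v} → v ∈ X → v ∈ A₂ → ⊥
        X∉A₂ x a = X∉A₁ x (proj₁ (B₁∩B₂⊆A₁∩A₂ (▷-cod W▷X x) (isKernel-dom⊆cod isKc₂ a)))
        Y∉A₁ : ∀ {v} → v ∈ Y → v ∈ A₁ → ⊥
        Y∉A₁ y a = Y∉A₂ y (proj₂ (B₁∩B₂⊆A₁∩A₂ (isKernel-dom⊆cod isKc₁ a) (▷-cod W▷Y y)))
        X∉E₁ : ∀ {v} → v ∈ X → v ∈ E₁ → ⊥
        X∉E₁ x m = Sum.[ X∉A₁ x , X∉A₂ x ] (∈-∪⁻ A₁ A₂ (⊑-dom∩cod⊆dom h⊑b₂ m (∈-∪⁺ˡ B₁ B₂ (▷-cod W▷X x))))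
        Y∉E₁ : ∀ {v} → v ∈ Y → v ∈ E₁ → ⊥
        Y∉E₁ y m = Sum.[ Y∉A₁ y , Y∉A₂ y ] (∈-∪⁻ A₁ A₂ (⊑-dom∩cod⊆dom h⊑b₂ m (∈-∪⁺ʳ B₁ B₂ (▷-cod W▷Y y))))
        E₁⊆W : E₁ ⊆ W
        E₁⊆W m with R⇒In₃ (isKernel-dom⊆cod isK₂ m)
        ... | inj₁ w = w
        ... | inj₂ (inj₁ x) = ⊥-elim (X∉E₁ x m)
        ... | inj₂ (inj₂ y) = ⊥-elim (Y∉E₁ y m)
        E₁≡W : E₁ ≡ W
        E₁≡W = ⊆-antisym-sorted sE₁ sW E₁⊆W (▷-cod ∅▷W)
        A₁≡W : A₁ ≡ W
        A₁≡W = ⊆-antisym-sorted sA₁ sW (λ m → E₁⊆W (⊑-dom h⊑b₂ (∈-∪⁺ˡ A₁ A₂ m))) (▷-dom W▷X)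
        A₂≡W : A₂ ≡ W
        A₂≡W = ⊆-antisym-sorted sA₂ sW (λ m → E₁⊆W (⊑-dom h⊑b₂ (∈-∪⁺ʳ A₁ A₂ m))) (▷-dom W▷Y)
        B₁∪B₂⊆In₃ : ∀ {v} → v ∈ B₁ ∪ B₂ → In₃ v
        B₁∪B₂⊆In₃ m = R⇒In₃ (⊑-cod h⊑b₂ m)
        B₁∖W≡X : B₁ ∖ W ≡ X
        B₁∖W≡X = ∖-≡ sB₁ sX (▷-cod W▷X) W#X λ b → case B₁∪B₂⊆In₃ (∈-∪⁺ˡ B₁ B₂ b) of λ where
          (inj₁ w) → inj₁ w
          (inj₂ (inj₁ x)) → inj₂ x
          (inj₂ (inj₂ y)) → ⊥-elim (Y∉A₁ y (proj₁ (B₁∩B₂⊆A₁∩A₂ b (▷-cod W▷Y y))))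
        B₂∖W≡Y : B₂ ∖ W ≡ Y
        B₂∖W≡Y = ∖-≡ sB₂ sY (▷-cod W▷Y) W#Y λ b → case B₁∪B₂⊆In₃ (∈-∪⁺ʳ B₁ B₂ b) of λ where
          (inj₁ w) → inj₁ w
          (inj₂ (inj₁ x)) → ⊥-elim (X∉A₂ x (proj₂ (B₁∩B₂⊆A₁∩A₂ (▷-cod W▷X x) b)))
          (inj₂ (inj₂ y)) → inj₂ y
        R⊆B₁∪B₂ : R ⊆ B₁ ∪ B₂
        R⊆B₁∪B₂ m with R⇒In₃ m
        ... | inj₁ w = ∈-∪⁺ˡ B₁ B₂ (isKernel-dom⊆cod isKc₁ (▷-dom W▷X w))
        ... | inj₂ (inj₁ x) = ∈-∪⁺ˡ B₁ B₂ (▷-cod W▷X x)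
        ... | inj₂ (inj₂ y) = ∈-∪⁺ʳ B₁ B₂ (▷-cod W▷Y y)
        rewiring = ⊑⇒rewire (∪-sorted sA₁ sA₂) h⊑b₂ (λ m → ∈-∪⁺ˡ A₁ A₂ (▷-dom W▷X (E₁⊆W m))) R⊆B₁∪B₂
        A₁∪A₂≡E₁ = proj₁ rewiring
        ψ = proj₁ (proj₂ rewiring)
        m₂≈ = proj₂ (proj₂ rewiring)

proposition8 : ∀ {o ℓ e : Level} (𝒱 : VarStructure) (C : MarkovCategory o ℓ e)
                 (θ : VarStructure.Var 𝒱 → MarkovCategory.Ob C) →
                 let open Theory 𝒱 C θ in
                 (W X Y : List Var) → Sorted W → Sorted X → Sorted Y →
                 Disjoint W X → Disjoint W Y → Disjoint X Y →
                 (s : Hom ⟦ [] ⟧ ⟦ (W ∪ X) ∪ Y ⟧) →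
                 IsKernel (mk [] ((W ∪ X) ∪ Y) s) →
                 (DisplaysCI W X Y s ⇔ DIBI-CI W X Y (mk [] ((W ∪ X) ∪ Y) s))
proposition8 𝒱 C θ W X Y sW sX sY W#X W#Y X#Y s _ = mk⇔ (forward s) (backward s)
  where open Proposition8.Setting 𝒱 C θ W X Y sW sX sY W#X W#Y X#Y
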